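{- There is a constant $c$ such that for every $n\ge1$, there is a $(\mathrm{Sym}_{n+1}\times\mathrm{Sym}_n)$-symmetric $\vec y$-linear IPS refutation of $\mathrm{PHP}(n+1,n)$ over $\mathbb{Q}$ of size at most $c\cdot 3^n\cdot n$.
   Context: Pigeonhole principle: $\mathrm{PHP}(n+1,n)\subseteq\mathbb{Q}[X]$ has variables $X=\{x_{ij}: i\in[n+1], j\in[n]\}$ and polynomials $x^2-x$ for $x\in X$, $\sum_{j\in[n]}x_{ij}-1$ for every $i\in[n+1]$, and $x_{ij}x_{i'j}$ for every $j\in[n]$ and $i\neq i'\in[n+1]$; it is unsatisfiable. $\mathrm{Sym}_{n+1}\times\mathrm{Sym}_n$ acts on $X$ by $(\pi,\sigma)(x_{ij})=x_{\pi(i)\sigma(j)}$, and $\mathrm{PHP}(n+1,n)$ is invariant. An algebraic circuit over variables $Z$ and field $\mathbb{F}$ is a connected DAG with input gates labelled by elements of $Z\cup\mathbb{F}$ and internal gates labelled $+$ or $\times$ (arbitrary fan-in), single output, computing a polynomial. It is $\Gamma$-symmetric (for $\Gamma$ acting on $Z$, trivially on $\mathbb{F}$) if each $\pi\in\Gamma$ extends to a DAG automorphism preserving internal labels and mapping each input gate labelled $z$ to one labelled $\pi(z)$. IPS: for $\mathcal{F}=\{f_1,\dots,f_m\}$ and fresh $Y=\{y_1,\dots,y_m\}$, an IPS certificate is $C(\vec x,\vec y)$ with $C(\vec x,\vec 0)=0$, $C(\vec x,f_1,\dots,f_m)=1$; an IPS refutation is a circuit over $X\uplus Y$ computing one; its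 size is $\max(\text{number of gates},|X|+|Y|)$; it is $\vec y$-linear if the certificate is $\sum_iy_ig_i(\vec x)$. For $\Gamma$-invariant $\mathcal{F}$, $\Gamma$ acts on $Y$ by $\pi(y_i)=y_j$ where $\pi(f_i)=f_j$; a $\Gamma$-symmetric IPS refutation is one that is a $\Gamma$-symmetric circuit w.r.t. this action on $X\uplus Y$. -}

module Defs where

open import Data.Nat as ℕ using (ℕ; zero; suc; _⊔_)
open import Data.Fin as Fin using (Fin; toℕ)
open import Data.Fin.Properties using (<-cmp; <-irrefl; _<?_)
open import Data.Fin.Permutation using (Permutation′; _⟨$⟩ʳ_; _⟨$⟩ˡ_; inverseˡ)
open import Data.Rational using (ℚ; 0ℚ; 1ℚ; _+_; _*_; _-_)
open import Data.List using (List; []; _∷_; foldr; concatMap; length; _++_; allFin; map)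
open import Data.Bool using (Bool; true; false; if_then_else_)
open import Data.Product using (_×_; _,_; ∃; Σ-syntax)
open import Data.Sum using (_⊎_; inj₁; inj₂)
open import Data.Empty using (⊥; ⊥-elim)
open import Data.Unit using (⊤)
open import Relation.Nullary using (¬_; yes; no)
open import Relation.Binary using (tri<; tri≈; tri>)
open import Relation.Binary.PropositionalEquality using (_≡_; _≢_; refl; sym; trans; cong)

ΣF : (k : ℕ) → (Fin k → ℚ) → ℚ
ΣF k f = foldr (λ j acc → f j + acc) 0ℚ (allFin k)

data Label (Z : Set) : Set where
  var   : Z → Label Z
  const : ℚ → Label Z
  plus  : Label Z
  times : Label Z

IsInput : {Z : Set} → Label Z → Set
IsInput (var _)   = ⊤
IsInput (const _) = ⊤
IsInput plus      = ⊥
IsInput times     = ⊥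

mapLabel : {Z : Set} → (Z → Z) → Label Z → Label Z
mapLabel f (var z)   = var (f z)
mapLabel f (const q) = const q
mapLabel f plus      = plus
mapLabel f times     = times

-- A circuit: gates are Fin gates; edge i j ≡ true means gate j is a child
-- (an input) of gate i.  Gates are numbered in a topological order
-- (children have smaller index), which makes the graph a DAG.
record Circuit (Z : Set) : Set where
  field
    gates  : ℕ
    label  : Fin gates → Label Z
    edge   : Fin gates → Fin gates → Bool
    out    : Fin gates
    topo   : ∀ i j → edge i j ≡ true → j Fin.< i
    leaves : ∀ i → IsInput (label i) → ∀ j → edge i j ≡ false
    outSink : ∀ i → edge i out ≡ false
    parent : ∀ j → j ≢ out → ∃ λ i → edge i j ≡ true

module _ {Z : Set} (C : Circuit Z) (a : Z → ℚ) where
  open Circuit C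

  sumCh : (Fin gates → Bool) → (Fin gates → ℚ) → ℚ
  sumCh b f = foldr (λ j acc → if b j then f j + acc else acc) 0ℚ (allFin gates)

  prodCh : (Fin gates → Bool) → (Fin gates → ℚ) → ℚ
  prodCh b f = foldr (λ j acc → if b j then f j * acc else acc) 1ℚ (allFin gates)

  evalF : ℕ → Fin gates → ℚ
  evalF zero    i = 0ℚ
  evalF (suc k) i with label i
  ... | var z   = a z
  ... | const q = q
  ... | plus    = sumCh (edge i) (evalF k)
  ... | times   = prodCh (edge i) (evalF k)

  -- fuel = number of gates exceeds the depth of every gate (topological order)
  eval : ℚ
  eval = evalF gates out

Symmetric : {Z G : Set} → (act : G → Z → Z) → Circuit Z → Set
Symmetric act C = ∀ g → Σ[ φ ∈ Permutation′ gates ]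
    ((∀ i j → edge (φ ⟨$⟩ʳ i) (φ ⟨$⟩ʳ j) ≡ edge i j)
   × (∀ i → label (φ ⟨$⟩ʳ i) ≡ mapLabel (act g) (label i)))
  where open Circuit C

XVar : ℕ → Set
XVar n = Fin (suc n) × Fin n

-- indices of the polynomials of PHP(n+1,n), i.e. the Y variables
data YVar (n : ℕ) : Set where
  bool : Fin (suc n) → Fin n → YVar n
  row  : Fin (suc n) → YVar n
  hole : Fin n → (i i′ : Fin (suc n)) → i Fin.< i′ → YVar n -- x_ij x_i′j  ({i,i′} unordered, i<i′)

allX : (n : ℕ) → List (XVar n)
allX n = concatMap (λ i → map (λ j → (i , j)) (allFin n)) (allFin (suc n))

allY : (n : ℕ) → List (YVar n)
allY n = concatMap (λ i → map (bool i) (allFin n)) (allFin (suc n))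
      ++ map row (allFin (suc n))
      ++ concatMap (λ j → concatMap (λ i → concatMap (λ i′ → pr j i i′) (allFin (suc n))) (allFin (suc n))) (allFin n)
  where
  pr : Fin n → (i i′ : Fin (suc n)) → List (YVar n)
  pr j i i′ with i <? i′
  ... | yes p = hole j i i′ p ∷ []
  ... | no _  = []

php : {n : ℕ} → YVar n → (XVar n → ℚ) → ℚ
php (bool i j)     x = x (i , j) * x (i , j) - x (i , j)
php {n} (row i)    x = ΣF n (λ j → x (i , j)) - 1ℚ
php (hole j i i′ _) x = x (i , j) * x (i′ , j)

SymGroup : ℕ → Set
SymGroup n = Permutation′ (suc n) × Permutation′ n

perm-inj : ∀ {m} (π : Permutation′ m) {a b} → π ⟨$⟩ʳ a ≡ π ⟨$⟩ʳ b → a ≡ b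
perm-inj π {a} {b} e = trans (sym (inverseˡ π)) (trans (cong (π ⟨$⟩ˡ_) e) (inverseˡ π))

actX : {n : ℕ} → SymGroup n → XVar n → XVar n
actX (π , σ) (i , j) = (π ⟨$⟩ʳ i , σ ⟨$⟩ʳ j)

-- induced action on Y: (π,σ)(f_y) = f_{(π,σ) y}
actY : {n : ℕ} → SymGroup n → YVar n → YVar n
actY (π , σ) (bool i j) = bool (π ⟨$⟩ʳ i) (σ ⟨$⟩ʳ j)
actY (π , σ) (row i)    = row (π ⟨$⟩ʳ i)
actY (π , σ) (hole j i i′ p) with <-cmp (π ⟨$⟩ʳ i) (π ⟨$⟩ʳ i′)
... | tri< q _ _ = hole (σ ⟨$⟩ʳ j) (π ⟨$⟩ʳ i) (π ⟨$⟩ʳ i′) q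
... | tri≈ _ e _ = ⊥-elim (<-irrefl (perm-inj π e) p)
... | tri> _ _ q = hole (σ ⟨$⟩ʳ j) (π ⟨$⟩ʳ i′) (π ⟨$⟩ʳ i) q

Var : ℕ → Set
Var n = XVar n ⊎ YVar n

act : {n : ℕ} → SymGroup n → Var n → Var n
act g (inj₁ x) = inj₁ (actX g x)
act g (inj₂ y) = inj₂ (actY g y)

assign : {n : ℕ} → (XVar n → ℚ) → (YVar n → ℚ) → Var n → ℚ
assign x y (inj₁ v) = x v
assign x y (inj₂ v) = y v

IsIPSRefutation : {n : ℕ} → Circuit (Var n) → Set
IsIPSRefutation {n} C =
    (∀ x → eval C (assign x (λ _ → 0ℚ)) ≡ 0ℚ)
  × (∀ x → eval C (assign x (λ y → php y x)) ≡ 1ℚ)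

sumY : {n : ℕ} → (YVar n → ℚ) → ℚ
sumY {n} f = foldr (λ k acc → f k + acc) 0ℚ (allY n)

YLinear : {n : ℕ} → Circuit (Var n) → Set
YLinear {n} C = Σ[ g ∈ (YVar n → (XVar n → ℚ) → ℚ) ]
  (∀ x y → eval C (assign x y) ≡ sumY (λ k → y k * g k x))

size : {n : ℕ} → Circuit (Var n) → ℕ
size {n} C = Circuit.gates C ⊔ (length (allX n) ℕ.+ length (allY n))

{-# OPTIONS --safe #-}
module Submission where

-- Write h_j = Σ_i x_ij for the number of pigeons in hole j. Substituting the axioms for the y-variables,
--   B_j = Σ_i y_{bool,i,j} + Σ_{i≠i′} y_{hole,j,{i,i′}}  becomes  h_j² − h_j,   and
--   R   = Σ_i y_{row,i}                                 becomes  Σ_j h_j − (n+1),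
-- so it suffices to find polynomials D_j and Ψ in h with Σ_j (h_j² − h_j) D_j − (Σ_j h_j − (n+1)) Ψ = 1.
-- Take Ψ = Σ_S w(|S|) h^S and D_j = Σ_{S∌j} w(|S|+1) h^S over subsets S of the holes. Multiplying out, the
-- left-hand side is Σ_S ((n+1) w(|S|) − |S| (w(|S|−1) + w(|S|))) h^S, which is the constant 1 for
-- w(k) = k! (n−k)! / (n+1)!. The certificate Σ_j B_j D_j − R Ψ is computed by a depth-three circuit with one
-- product gate for every pair (j, S) and every S, hence with O(n 2ⁿ) gates, and permuting pigeons and holes
-- permutes its gates, which makes it symmetric.

open import Algebra.Bundles using (Monoid; CommutativeMonoid; Ring)
open import Data.Bool as Bool using (Bool; true; false; if_then_else_)
open import Data.Empty using (⊥-elim)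
open import Data.Fin as Fin using (Fin; zero; suc; toℕ; _↑ˡ_; _↑ʳ_; remQuot; combine)
open import Data.Fin.Permutation using (Permutation′; _⟨$⟩ʳ_; _⟨$⟩ˡ_; inverseˡ; flip)
open import Data.Fin.Properties
  using (+↔⊎; *↔×; 1↔⊤; 2↔Bool; splitAt-↑ˡ; splitAt-↑ʳ; remQuot-combine; toℕ<n; toℕ-↑ˡ; toℕ-↑ʳ)
open import Data.Fin.Properties using (<-cmp; <-irrefl; <-asym; <-irrelevant; _<?_)
open import Data.Fin.Subset using (Subset; ∣_∣)
open import Data.Fin.Subset.Properties using (∣p∣≤n)
open import Data.List as List using (List; []; _∷_; _++_; foldr; concat; concatMap; allFin; tabulate)
import Data.List.Properties as ListP
open import Data.Nat as ℕ using (ℕ; _!; _^_)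
import Data.Nat.Properties as ℕ
open import Data.Nat.Properties using (_!≢0)
open import Data.Nat.Tactic.RingSolver using () renaming (solve-∀ to ℕ-solve-∀)
open import Data.Product as Product using (_×_; _,_; ∃; Σ-syntax; proj₁; proj₂)
open import Data.Product.Function.NonDependent.Propositional using (_×-↔_)
open import Data.Rational as ℚ using (ℚ; 0ℚ; 1ℚ)
import Data.Rational.Properties as ℚ
open import Data.Sum as Sum using (_⊎_; inj₁; inj₂)
open import Data.Sum.Function.Propositional using (_⊎-↔_)
open import Data.Unit using (⊤; tt)
open import Data.Vec as Vec using (Vec; []; _∷_; lookup)
import Data.Vec.Properties as VecP
open import Function using (_↔_; Inverse; mk↔ₛ′; mk⇔; _∘_; id)
open import Function.Properties.Inverse using (↔-refl; ↔-sym; ↔-trans)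
open import Level using (0ℓ)
open import Relation.Binary.Definitions using (DecidableEquality; tri<; tri≈; tri>)
open import Relation.Binary.PropositionalEquality using (_≡_; _≢_; refl; cong; cong₂; sym; trans; subst; subst₂; module ≡-Reasoning)
open import Relation.Nullary using (does; yes; no; ¬_)
open import Relation.Nullary.Decidable using (does-⇔; dec⇒maybe; dec-true; dec-false)
open import Tactic.RingSolver using (solve-∀)
open import Tactic.RingSolver.Core.AlmostCommutativeRing using (AlmostCommutativeRing; fromCommutativeRing)

open import Algebra.Properties.CommutativeMonoid.Sum ℕ.+-0-commutativeMonoid using ()
  renaming (sum to ℕ-sum; sum-cong-≗ to ℕ-sum-cong-≗; sum-permute to ℕ-sum-permute)

open import Defs

open ≡-Reasoning

-- Finite types and big operators

record Finite (A : Set) : Set where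
  field
    card  : ℕ
    index : A ↔ Fin card

open Finite using (card; index)

module _ {A : Set} ⦃ FA : Finite A ⦄ where

  encode : A → Fin (card FA)
  encode = Inverse.to (index FA)

  decode : Fin (card FA) → A
  decode = Inverse.from (index FA)

  encode-decode : ∀ i → encode (decode i) ≡ i
  encode-decode = Inverse.strictlyInverseˡ (index FA)

  decode-encode : ∀ a → decode (encode a) ≡ a
  decode-encode = Inverse.strictlyInverseʳ (index FA)

Vec0↔⊤ : ∀ {A : Set} → Vec A 0 ↔ ⊤
Vec0↔⊤ = mk↔ₛ′ (λ _ → tt) (λ _ → []) (λ _ → refl) (λ { [] → refl })

Vec-suc↔× : ∀ {A : Set} {n} → Vec A (ℕ.suc n) ↔ (A × Vec A n)
Vec-suc↔× = mk↔ₛ′ (λ { (a ∷ as) → a , as }) (λ (a , as) → a ∷ as) (λ _ → refl) (λ { (a ∷ as) → refl })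

instance
  Fin-finite : ∀ {k} → Finite (Fin k)
  Fin-finite {k} = record { card = k ; index = ↔-refl }

  ⊤-finite : Finite ⊤
  ⊤-finite = record { card = 1 ; index = ↔-sym 1↔⊤ }

  Bool-finite : Finite Bool
  Bool-finite = record { card = 2 ; index = ↔-sym 2↔Bool }

  ⊎-finite : ∀ {A B} ⦃ FA : Finite A ⦄ ⦃ FB : Finite B ⦄ → Finite (A ⊎ B)
  ⊎-finite ⦃ FA ⦄ ⦃ FB ⦄ = record { card = card FA ℕ.+ card FB ; index = ↔-trans (index FA ⊎-↔ index FB) (↔-sym +↔⊎) }

  ×-finite : ∀ {A B} ⦃ FA : Finite A ⦄ ⦃ FB : Finite B ⦄ → Finite (A × B)
  ×-finite ⦃ FA ⦄ ⦃ FB ⦄ = record { card = card FA ℕ.* card FB ; index = ↔-trans (index FA ×-↔ index FB) (↔-sym *↔×) }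

  Subset-finite : ∀ {n} → Finite (Subset n)
  Subset-finite {ℕ.zero}  = record { card = 1 ; index = ↔-trans Vec0↔⊤ (index ⊤-finite) }
  Subset-finite {ℕ.suc n} = record
    { card  = 2 ℕ.* card (Subset-finite {n})
    ; index = ↔-trans Vec-suc↔× (index (×-finite ⦃ Bool-finite ⦄ ⦃ Subset-finite {n} ⦄))
    }

cardinality : (A : Set) ⦃ FA : Finite A ⦄ → ℕ
cardinality A ⦃ FA ⦄ = card FA

cardinality-Subset : ∀ n → cardinality (Subset n) ≡ 2 ^ n
cardinality-Subset ℕ.zero    = refl
cardinality-Subset (ℕ.suc n) = cong (2 ℕ.*_) (cardinality-Subset n)

module _ {A B : Set} ⦃ FA : Finite A ⦄ ⦃ FB : Finite B ⦄ where

  encode-inj₁<inj₂ : ∀ (a : A) (b : B) → encode (inj₁ {B = B} a) Fin.< encode (inj₂ {A = A} b)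
  encode-inj₁<inj₂ a b rewrite toℕ-↑ˡ (encode a) (card FB) | toℕ-↑ʳ (card FA) (encode b) =
    ℕ.≤-trans (toℕ<n (encode a)) (ℕ.m≤m+n (card FA) _)

  encode-inj₂-mono : ∀ (b b′ : B) → encode b Fin.< encode b′ → encode (inj₂ {A = A} b) Fin.< encode (inj₂ {A = A} b′)
  encode-inj₂-mono b b′ b<b′ rewrite toℕ-↑ʳ (card FA) (encode b) | toℕ-↑ʳ (card FA) (encode b′) =
    ℕ.+-monoʳ-< (card FA) b<b′

module Big (M : Monoid 0ℓ 0ℓ) where
  open Monoid M using (Carrier; _≈_; _∙_; ε; assoc; identityˡ; identityʳ; ∙-cong; ∙-congˡ; ∙-congʳ)
    renaming (refl to ≈-refl; sym to ≈-sym; trans to ≈-trans; reflexive to ≈-reflexive)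
  open import Algebra.Properties.Monoid.Sum M using (sum; sum-cong-≋; sum-cong-≗; sum-replicate-zero)

  sum-↑ : ∀ m {n} (f : Fin (m ℕ.+ n) → Carrier) → sum f ≈ sum (f ∘ (_↑ˡ n)) ∙ sum (f ∘ (m ↑ʳ_))
  sum-↑ ℕ.zero    f = ≈-sym (identityˡ _)
  sum-↑ (ℕ.suc m) f = ≈-trans (∙-congˡ (sum-↑ m (f ∘ suc))) (≈-sym (assoc _ _ _))

  sum-combine : ∀ m n (f : Fin (m ℕ.* n) → Carrier) → sum f ≈ sum (λ i → sum (λ j → f (combine {m} {n} i j)))
  sum-combine ℕ.zero    n f = ≈-refl
  sum-combine (ℕ.suc m) n f = ≈-trans (sum-↑ n f) (∙-congˡ (sum-combine m n (f ∘ (n ↑ʳ_))))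

  sum-δ : ∀ {k} (i₀ : Fin k) (g : Fin k → Carrier) → sum (λ i → if does (i₀ Fin.≟ i) then g i else ε) ≈ g i₀
  sum-δ {ℕ.suc k} zero     g = ≈-trans (∙-congˡ (sum-replicate-zero k)) (identityʳ (g zero))
  sum-δ {ℕ.suc k} (suc i₀) g = ≈-trans (identityˡ _) (sum-δ i₀ (g ∘ suc))

  module _ {A : Set} ⦃ FA : Finite A ⦄ where

    big : (A → Carrier) → Carrier
    big f = sum (f ∘ decode)

  big-ε : ∀ A ⦃ FA : Finite A ⦄ → big (λ (_ : A) → ε) ≈ ε
  big-ε A ⦃ FA ⦄ = sum-replicate-zero (card FA)

  module _ {A : Set} ⦃ FA : Finite A ⦄ where

    big-cong : ∀ {f g : A → Carrier} → (∀ a → f a ≈ g a) → big f ≈ big g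
    big-cong f≈g = sum-cong-≋ (f≈g ∘ decode)

    big-if : ∀ (b : Bool) (f : A → Carrier) → big (λ a → if b then f a else ε) ≈ (if b then big f else ε)
    big-if true  f = ≈-refl
    big-if false f = big-ε A

    big-δ : ∀ (_≟_ : DecidableEquality A) (a : A) (f : A → Carrier) → big (λ b → if does (a ≟ b) then f b else ε) ≈ f a
    big-δ _≟_ a f = ≈-trans (≈-reflexive (sum-cong-≗ same-test)) (≈-trans (sum-δ (encode a) (f ∘ decode))
      (≈-reflexive (cong f (decode-encode a))))
      where
      same-test : ∀ i → (if does (a ≟ decode i) then f (decode i) else ε) ≡ (if does (encode a Fin.≟ i) then f (decode i) else ε)
      same-test i = cong (if_then f (decode i) else ε) (does-⇔ (mk⇔
        (λ a≡ → trans (cong encode a≡) (encode-decode {A = A} i))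
        (λ ≡i → trans (sym (decode-encode a)) (cong decode ≡i))) (a ≟ decode i) (encode a Fin.≟ i))

  module _ {A B : Set} ⦃ FA : Finite A ⦄ ⦃ FB : Finite B ⦄ where

    big-⊎ : (f : A ⊎ B → Carrier) → big f ≈ big (f ∘ inj₁) ∙ big (f ∘ inj₂)
    big-⊎ f = ≈-trans (sum-↑ (card FA) _) (∙-cong
      (≈-reflexive (sum-cong-≗ (λ i → cong (f ∘ Sum.map decode decode) (splitAt-↑ˡ (card FA) i (card FB)))))
      (≈-reflexive (sum-cong-≗ (λ i → cong (f ∘ Sum.map decode decode) (splitAt-↑ʳ (card FA) (card FB) i)))))

    big-inj₁ : (f : A ⊎ B → Carrier) → (∀ b → f (inj₂ b) ≈ ε) → big f ≈ big (f ∘ inj₁)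
    big-inj₁ f f₂≈ε = ≈-trans (big-⊎ f) (≈-trans (∙-congˡ (≈-trans (big-cong f₂≈ε) (big-ε B))) (identityʳ _))

    big-inj₂ : (f : A ⊎ B → Carrier) → (∀ a → f (inj₁ a) ≈ ε) → big f ≈ big (f ∘ inj₂)
    big-inj₂ f f₁≈ε = ≈-trans (big-⊎ f) (≈-trans (∙-congʳ (≈-trans (big-cong f₁≈ε) (big-ε A))) (identityˡ _))

    big-× : (f : A × B → Carrier) → big f ≈ big (λ a → big (λ b → f (a , b)))
    big-× f = ≈-trans (sum-combine (card FA) (card FB) _) (≈-reflexive (sum-cong-≗ (λ i → sum-cong-≗ (λ j →
      cong (f ∘ Product.map decode decode) (remQuot-combine i j)))))

  big-⊤ : (f : ⊤ → Carrier) → big f ≈ f tt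
  big-⊤ f = identityʳ (f tt)

  big-Subset-suc : ∀ {n} (f : Subset (ℕ.suc n) → Carrier) → big f ≈ big (λ S → f (false ∷ S)) ∙ big (λ S → f (true ∷ S))
  big-Subset-suc f = ≈-trans (big-× (λ (b , S) → f (b ∷ S))) (∙-congˡ (identityʳ _))

module Sums = Big ℚ.+-0-monoid
module Products = Big ℚ.*-1-monoid

-- Circuits with a finite type of gates

foldr-if-cong : ∀ {X C : Set} (_∙_ : C → C → C) (e : C) (b : X → Bool) {f g : X → C} (xs : List X) →
  (∀ x → b x ≡ true → f x ≡ g x) →
  foldr (λ x acc → if b x then f x ∙ acc else acc) e xs ≡ foldr (λ x acc → if b x then g x ∙ acc else acc) e xs
foldr-if-cong _∙_ e b []       f≈g = refl
foldr-if-cong _∙_ e b (x ∷ xs) f≈g with b x in bx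
... | true  = cong₂ _∙_ (f≈g x bx) (foldr-if-cong _∙_ e b xs f≈g)
... | false = foldr-if-cong _∙_ e b xs f≈g

module _ (M : Monoid 0ℓ 0ℓ) where
  open Monoid M using (Carrier; _≈_; _∙_; ε; identityˡ; ∙-congˡ) renaming (refl to ≈-refl; sym to ≈-sym; trans to ≈-trans)
  open import Algebra.Properties.Monoid.Sum M using (sum)

  foldr-if-tabulate : ∀ {X : Set} n (b : X → Bool) (f : X → Carrier) (g : Fin n → X) →
    foldr (λ x acc → if b x then f x ∙ acc else acc) ε (tabulate g) ≈ sum (λ j → if b (g j) then f (g j) else ε)
  foldr-if-tabulate ℕ.zero    b f g = ≈-refl
  foldr-if-tabulate (ℕ.suc n) b f g with b (g zero)
  ... | true  = ∙-congˡ (foldr-if-tabulate n b f (g ∘ suc))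
  ... | false = ≈-trans (foldr-if-tabulate n b f (g ∘ suc)) (≈-sym (identityˡ _))

module Evaluation {Z : Set} (C : Circuit Z) (ρ : Z → ℚ) where
  open Circuit C

  step : (Fin gates → ℚ) → Fin gates → ℚ
  step f i with label i
  ... | var z   = ρ z
  ... | const q = q
  ... | plus    = sumCh C ρ (edge i) f
  ... | times   = prodCh C ρ (edge i) f

  evalF-suc : ∀ k i → evalF C ρ (ℕ.suc k) i ≡ step (evalF C ρ k) i
  evalF-suc k i with label i
  ... | var z   = refl
  ... | const q = refl
  ... | plus    = refl
  ... | times   = refl

  step-cong : ∀ {f g} i → (∀ j → edge i j ≡ true → f j ≡ g j) → step f i ≡ step g i
  step-cong i f≈g with label i
  ... | var z   = refl
  ... | const q = refl
  ... | plus    = foldr-if-cong ℚ._+_ 0ℚ (edge i) (allFin gates) f≈g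
  ... | times   = foldr-if-cong ℚ._*_ 1ℚ (edge i) (allFin gates) f≈g

  evalF-fixed-point : (v : Fin gates → ℚ) → (∀ i → v i ≡ step v i) → ∀ k i → toℕ i ℕ.< k → evalF C ρ k i ≡ v i
  evalF-fixed-point v fixed (ℕ.suc k) i i<k = begin
    evalF C ρ (ℕ.suc k) i  ≡⟨ evalF-suc k i ⟩
    step (evalF C ρ k) i   ≡⟨ step-cong i (λ j e → evalF-fixed-point v fixed k j (ℕ.≤-trans (topo i j e) (ℕ.s≤s⁻¹ i<k))) ⟩
    step v i               ≡⟨ sym (fixed i) ⟩
    v i                    ∎

  eval-fixed-point : (v : Fin gates → ℚ) → (∀ i → v i ≡ step v i) → eval C ρ ≡ v out
  eval-fixed-point v fixed = evalF-fixed-point v fixed gates out (toℕ<n out)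

-- Only input labels are ever evaluated; plus and times get the junk value 0.
input-value : ∀ {Z : Set} → (Z → ℚ) → Label Z → ℚ
input-value ρ (var z)   = ρ z
input-value ρ (const q) = q
input-value ρ plus      = 0ℚ
input-value ρ times     = 0ℚ

record FiniteCircuit (Z : Set) : Set₁ where
  field
    Gate              : Set
    ⦃ Gate-finite ⦄   : Finite Gate
    label             : Gate → Label Z
    edge              : Gate → Gate → Bool
    output            : Gate
    edge-descends     : ∀ a b → edge a b ≡ true → encode b Fin.< encode a
    inputs-are-leaves : ∀ a → IsInput (label a) → ∀ b → edge a b ≡ false
    output-is-sink    : ∀ a → edge a output ≡ false
    has-parent        : ∀ b → b ≢ output → ∃ λ a → edge a b ≡ true

  circuit : Circuit Z
  circuit = record
    { gates   = card Gate-finite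
    ; label   = label ∘ decode
    ; edge    = λ i j → edge (decode i) (decode j)
    ; out     = encode output
    ; topo    = λ i j e → subst₂ Fin._<_ (encode-decode {A = Gate} j) (encode-decode {A = Gate} i) (edge-descends _ _ e)
    ; leaves  = λ i input j → inputs-are-leaves _ input _
    ; outSink = λ i → subst (λ b → edge (decode i) b ≡ false) (sym (decode-encode output)) (output-is-sink _)
    ; parent  = parent
    }
    where
    parent : ∀ j → j ≢ encode output → ∃ λ i → edge (decode i) (decode j) ≡ true
    parent j j≢out =
      let (a , e) = has-parent (decode j) (λ j≡out → j≢out (trans (sym (encode-decode {A = Gate} j)) (cong encode j≡out)))
      in encode a , subst (λ c → edge c (decode j) ≡ true) (sym (decode-encode a)) e

  symmetric : ∀ {G : Set} (act : G → Z → Z) (α : G → Gate ↔ Gate) →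
    (∀ g a b → edge (Inverse.to (α g) a) (Inverse.to (α g) b) ≡ edge a b) →
    (∀ g a → label (Inverse.to (α g) a) ≡ mapLabel (act g) (label a)) →
    Symmetric act circuit
  symmetric act α α-edge α-label g = φ , φ-edge , φ-label
    where
    φ : Permutation′ (card Gate-finite)
    φ = ↔-trans (↔-sym (index Gate-finite)) (↔-trans (α g) (index Gate-finite))

    φ-edge : ∀ i j → edge (decode (φ ⟨$⟩ʳ i)) (decode (φ ⟨$⟩ʳ j)) ≡ edge (decode i) (decode j)
    φ-edge i j rewrite decode-encode (Inverse.to (α g) (decode i)) | decode-encode (Inverse.to (α g) (decode j)) = α-edge g _ _

    φ-label : ∀ i → label (decode (φ ⟨$⟩ʳ i)) ≡ mapLabel (act g) (label (decode i))
    φ-label i rewrite decode-encode (Inverse.to (α g) (decode i)) = α-label g _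

  module _ (ρ : Z → ℚ) where

    gate-step : (Gate → ℚ) → Gate → ℚ
    gate-step v a with label a
    ... | var z   = ρ z
    ... | const q = q
    ... | plus    = Sums.big (λ b → if edge a b then v b else 0ℚ)
    ... | times   = Products.big (λ b → if edge a b then v b else 1ℚ)

    gate-step-input : ∀ v a → IsInput (label a) → gate-step v a ≡ input-value ρ (label a)
    gate-step-input v a input with label a
    ... | var z   = refl
    ... | const q = refl

    eval-circuit : (v : Gate → ℚ) → (∀ a → v a ≡ gate-step v a) → eval circuit ρ ≡ v output
    eval-circuit v fixed = trans (Evaluation.eval-fixed-point circuit ρ (v ∘ decode) fixed-on-indices) (cong v (decode-encode output))
      where
      children : Fin (card Gate-finite) → Fin (card Gate-finite) → Bool
      children i j = edge (decode i) (decode j)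

      fixed-on-indices : ∀ i → v (decode i) ≡ Evaluation.step circuit ρ (v ∘ decode) i
      fixed-on-indices i with label (decode i) | fixed (decode i)
      ... | var z   | eq = eq
      ... | const q | eq = eq
      ... | plus    | eq = trans eq (sym (foldr-if-tabulate ℚ.+-0-monoid (card Gate-finite) (children i) (v ∘ decode) (λ j → j)))
      ... | times   | eq = trans eq (sym (foldr-if-tabulate ℚ.*-1-monoid (card Gate-finite) (children i) (v ∘ decode) (λ j → j)))

-- Subsets, permutations and counting

does-≟-injective : ∀ {A B : Set} (_≟A_ : DecidableEquality A) (_≟B_ : DecidableEquality B) (f : A → B) →
  (∀ {x y} → f x ≡ f y → x ≡ y) → ∀ x y → does (f x ≟B f y) ≡ does (x ≟A y)
does-≟-injective _≟A_ _≟B_ f f-injective x y = does-⇔ (mk⇔ f-injective (cong f)) (f x ≟B f y) (x ≟A y)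

_≟ˢ_ : ∀ {m} → DecidableEquality (Subset m)
_≟ˢ_ = VecP.≡-dec Bool._≟_

permute : ∀ {m} → Permutation′ m → Subset m → Subset m
permute σ S = Vec.tabulate (λ t → lookup S (σ ⟨$⟩ˡ t))

lookup-permute : ∀ {m} (σ : Permutation′ m) S t → lookup (permute σ S) (σ ⟨$⟩ʳ t) ≡ lookup S t
lookup-permute σ S t = trans (VecP.lookup∘tabulate _ (σ ⟨$⟩ʳ t)) (cong (lookup S) (inverseˡ σ))

permute-inverse : ∀ {m} (σ : Permutation′ m) S → permute (flip σ) (permute σ S) ≡ S
permute-inverse σ S = trans (VecP.tabulate-cong (lookup-permute σ S)) (VecP.tabulate∘lookup S)

permute-injective : ∀ {m} (σ : Permutation′ m) {S S′} → permute σ S ≡ permute σ S′ → S ≡ S′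
permute-injective σ {S} {S′} eq = trans (sym (permute-inverse σ S)) (trans (cong (permute (flip σ)) eq) (permute-inverse σ S′))

does-≟-⟨$⟩ʳ : ∀ {m} (σ : Permutation′ m) j j′ → does ((σ ⟨$⟩ʳ j) Fin.≟ (σ ⟨$⟩ʳ j′)) ≡ does (j Fin.≟ j′)
does-≟-⟨$⟩ʳ σ = does-≟-injective Fin._≟_ Fin._≟_ (σ ⟨$⟩ʳ_) (perm-inj σ)

does-≟ˢ-permute : ∀ {m} (σ : Permutation′ m) S S′ → does (permute σ S ≟ˢ permute σ S′) ≡ does (S ≟ˢ S′)
does-≟ˢ-permute σ = does-≟-injective _≟ˢ_ _≟ˢ_ (permute σ) (permute-injective σ)

∣∣-as-sum : ∀ {m} (S : Subset m) → ∣ S ∣ ≡ ℕ-sum (λ t → if lookup S t then 1 else 0)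
∣∣-as-sum []          = refl
∣∣-as-sum (true ∷ S)  = cong ℕ.suc (∣∣-as-sum S)
∣∣-as-sum (false ∷ S) = ∣∣-as-sum S

∣permute∣ : ∀ {m} (σ : Permutation′ m) S → ∣ permute σ S ∣ ≡ ∣ S ∣
∣permute∣ σ S = begin
  ∣ permute σ S ∣
    ≡⟨ ∣∣-as-sum (permute σ S) ⟩
  ℕ-sum (λ t → if lookup (permute σ S) t then 1 else 0)
    ≡⟨ ℕ-sum-cong-≗ (cong (if_then 1 else 0) ∘ VecP.lookup∘tabulate (lookup S ∘ (σ ⟨$⟩ˡ_))) ⟩
  ℕ-sum (λ t → if lookup S (σ ⟨$⟩ˡ t) then 1 else 0)
    ≡⟨ ℕ-sum-permute (λ t → if lookup S t then 1 else 0) (flip σ) ⟨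
  ℕ-sum (λ t → if lookup S t then 1 else 0)
    ≡⟨ ∣∣-as-sum S ⟨
  ∣ S ∣ ∎

length-concatMap-allFin : ∀ {A : Set} {m k} (f : Fin m → List A) → (∀ i → List.length (f i) ℕ.≤ k) →
  List.length (concatMap f (allFin m)) ℕ.≤ m ℕ.* k
length-concatMap-allFin {m = m} {k} f bound =
  subst (λ l → List.length (concatMap f (allFin m)) ℕ.≤ l ℕ.* k) (ListP.length-tabulate {n = m} id) (go (allFin m))
  where
  go : ∀ is → List.length (concatMap f is) ℕ.≤ List.length is ℕ.* k
  go []       = ℕ.z≤n
  go (i ∷ is) = subst (ℕ._≤ k ℕ.+ List.length is ℕ.* k) (sym (ListP.length-++ (f i))) (ℕ.+-mono-≤ (bound i) (go is))

length-map-allFin : ∀ {A : Set} {m} (f : Fin m → A) → List.length (List.map f (allFin m)) ≡ m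
length-map-allFin {m = m} f = trans (ListP.length-map f (allFin m)) (ListP.length-tabulate id)

n<3^n : ∀ n → n ℕ.< 3 ^ n
n<3^n ℕ.zero    = ℕ.z<s
n<3^n (ℕ.suc n) = subst (ℕ._≤ 3 ^ ℕ.suc n) (ℕ.+-comm (ℕ.suc n) 1)
  (ℕ.+-mono-≤ (n<3^n n) (ℕ.≤-trans (ℕ.m^n>0 3 n) (ℕ.m≤m+n (3 ^ n) _)))

n*n≤3^n : ∀ n → n ℕ.* n ℕ.≤ 3 ^ n
n*n≤3^n ℕ.zero    = ℕ.z≤n
n*n≤3^n (ℕ.suc n) = subst₂ ℕ._≤_ (square n) (triple (3 ^ n))
  (ℕ.+-mono-≤ (n*n≤3^n n) (ℕ.+-mono-≤ (ℕ.<⇒≤ (n<3^n n)) (n<3^n n)))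
  where
  square : ∀ n → n ℕ.* n ℕ.+ (n ℕ.+ ℕ.suc n) ≡ ℕ.suc n ℕ.* ℕ.suc n
  square = ℕ-solve-∀
  triple : ∀ t → t ℕ.+ (t ℕ.+ t) ≡ 3 ℕ.* t
  triple = ℕ-solve-∀

gate-polynomial : ℕ → ℕ → ℕ
gate-polynomial n s = n ℕ.* (n ℕ.* n) ℕ.+ 4 ℕ.* (n ℕ.* n) ℕ.+ 6 ℕ.* n ℕ.+ 4 ℕ.+ 3 ℕ.* s ℕ.+ n ℕ.* s

gate-polynomial-bound : ∀ n s → 1 ℕ.≤ n → s ℕ.≤ 3 ^ n → gate-polynomial n s ℕ.≤ 19 ℕ.* 3 ^ n ℕ.* n
gate-polynomial-bound n s 1≤n s≤t = ℕ.≤-trans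
  (ℕ.+-mono-≤ (ℕ.+-mono-≤ (ℕ.+-mono-≤ (ℕ.+-mono-≤ (ℕ.+-mono-≤ cubic (ℕ.*-monoʳ-≤ 4 quadratic)) (ℕ.*-monoʳ-≤ 6 linear))
    (ℕ.*-monoʳ-≤ 4 constant)) (ℕ.*-monoʳ-≤ 3 subsets)) weighted-subsets)
  (ℕ.≤-reflexive (nineteen (3 ^ n) n))
  where
  t = 3 ^ n
  cubic : n ℕ.* (n ℕ.* n) ℕ.≤ t ℕ.* n
  cubic = subst (ℕ._≤ t ℕ.* n) (ℕ.*-comm (n ℕ.* n) n) (ℕ.*-monoˡ-≤ n (n*n≤3^n n))
  quadratic : n ℕ.* n ℕ.≤ t ℕ.* n
  quadratic = ℕ.*-monoˡ-≤ n (ℕ.<⇒≤ (n<3^n n))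
  linear : n ℕ.≤ t ℕ.* n
  linear = subst (ℕ._≤ t ℕ.* n) (ℕ.*-identityˡ n) (ℕ.*-monoˡ-≤ n (ℕ.m^n>0 3 n))
  constant : 1 ℕ.≤ t ℕ.* n
  constant = ℕ.*-mono-≤ (ℕ.m^n>0 3 n) 1≤n
  subsets : s ℕ.≤ t ℕ.* n
  subsets = ℕ.≤-trans s≤t (subst (ℕ._≤ t ℕ.* n) (ℕ.*-identityʳ t) (ℕ.*-monoʳ-≤ t 1≤n))
  weighted-subsets : n ℕ.* s ℕ.≤ t ℕ.* n
  weighted-subsets = subst (ℕ._≤ t ℕ.* n) (ℕ.*-comm s n) (ℕ.*-monoˡ-≤ n s≤t)
  nineteen : ∀ t n → t ℕ.* n ℕ.+ 4 ℕ.* (t ℕ.* n) ℕ.+ 6 ℕ.* (t ℕ.* n) ℕ.+ 4 ℕ.* (t ℕ.* n) ℕ.+ 3 ℕ.* (t ℕ.* n) ℕ.+ t ℕ.* n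
           ≡ 19 ℕ.* t ℕ.* n
  nineteen = ℕ-solve-∀

infixr 1 _⊎ᶠ_
infixr 2 _×ᶠ_

_⊎ᶠ_ : ∀ {A B C D : Set} → (A → C) → (B → D) → A ⊎ B → C ⊎ D
_⊎ᶠ_ = Sum.map

_×ᶠ_ : ∀ {A B C D : Set} → (A → C) → (B → D) → A × B → C × D
(f ×ᶠ g) (a , b) = f a , g b

-- ℚ arithmetic is opened only inside this module, so that _*_ in the final statement is that of ℕ.
module _ where
  open import Data.Rational using (_+_; _*_; _-_; -_; 1/_)
  open import Algebra.Properties.CommutativeSemigroup (CommutativeMonoid.commutativeSemigroup ℚ.*-1-commutativeMonoid) using (x∙yz≈y∙xz)
  open import Algebra.Properties.Semiring.Mult (Ring.semiring ℚ.+-*-ring) using (×-homo-+; ×1-homo-*) renaming (_×_ to _·_)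
  open import Algebra.Properties.Semiring.Sum (Ring.semiring ℚ.+-*-ring) using (∑-distrib-+; ∑-comm; *-distribˡ-sum; *-distribʳ-sum; sum-replicate)

  -- Without a genuine zero test on coefficients the solver cannot cancel terms such as x - x.
  ℚ-ring : AlmostCommutativeRing 0ℓ 0ℓ
  ℚ-ring = fromCommutativeRing ℚ.+-*-commutativeRing (λ q → dec⇒maybe (0ℚ ℚ.≟ q))

  ∑ : ∀ {A} ⦃ FA : Finite A ⦄ → (A → ℚ) → ℚ
  ∑ = Sums.big

  ∏ : ∀ {A} ⦃ FA : Finite A ⦄ → (A → ℚ) → ℚ
  ∏ = Products.big

  module _ {A : Set} ⦃ FA : Finite A ⦄ where

    ∑-+ : ∀ (f g : A → ℚ) → ∑ (λ a → f a + g a) ≡ ∑ f + ∑ g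
    ∑-+ f g = ∑-distrib-+ (f ∘ decode) (g ∘ decode)

    ∑-*ˡ : ∀ c (f : A → ℚ) → ∑ (λ a → c * f a) ≡ c * ∑ f
    ∑-*ˡ c f = sym (*-distribˡ-sum c (f ∘ decode))

    ∑-*ʳ : ∀ c (f : A → ℚ) → ∑ (λ a → f a * c) ≡ ∑ f * c
    ∑-*ʳ c f = sym (*-distribʳ-sum c (f ∘ decode))

    ∑-- : ∀ (f g : A → ℚ) → ∑ (λ a → f a - g a) ≡ ∑ f - ∑ g
    ∑-- f g = begin
      ∑ (λ a → f a - g a)           ≡⟨ Sums.big-cong (λ a → as-sum (f a) (g a)) ⟩
      ∑ (λ a → f a + - 1ℚ * g a)    ≡⟨ ∑-+ f (λ a → - 1ℚ * g a) ⟩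
      ∑ f + ∑ (λ a → - 1ℚ * g a)    ≡⟨ cong (∑ f +_) (∑-*ˡ (- 1ℚ) g) ⟩
      ∑ f + - 1ℚ * ∑ g              ≡⟨ as-sum (∑ f) (∑ g) ⟨
      ∑ f - ∑ g                     ∎
      where
      as-sum : ∀ x y → x - y ≡ x + - 1ℚ * y
      as-sum = solve-∀ ℚ-ring

  listSum : ∀ {A : Set} → (A → ℚ) → List A → ℚ
  listSum f = foldr (λ a acc → f a + acc) 0ℚ

  listSum-++ : ∀ {A : Set} (f : A → ℚ) xs ys → listSum f (xs ++ ys) ≡ listSum f xs + listSum f ys
  listSum-++ f []       ys = sym (ℚ.+-identityˡ _)
  listSum-++ f (x ∷ xs) ys = trans (cong (f x +_) (listSum-++ f xs ys)) (sym (ℚ.+-assoc (f x) _ _))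

  listSum-concatMap : ∀ {A B : Set} (f : B → ℚ) (g : A → List B) xs → listSum f (concatMap g xs) ≡ listSum (listSum f ∘ g) xs
  listSum-concatMap f g []       = refl
  listSum-concatMap f g (x ∷ xs) = trans (listSum-++ f (g x) (concatMap g xs)) (cong (listSum f (g x) +_) (listSum-concatMap f g xs))

  listSum-map : ∀ {A B : Set} (f : B → ℚ) (g : A → B) xs → listSum f (List.map g xs) ≡ listSum (f ∘ g) xs
  listSum-map f g []       = refl
  listSum-map f g (x ∷ xs) = cong (f (g x) +_) (listSum-map f g xs)

  listSum-allFin : ∀ k (f : Fin k → ℚ) → listSum f (allFin k) ≡ ∑ f
  listSum-allFin k f = foldr-if-tabulate ℚ.+-0-monoid k (λ _ → true) f id

  listSum-concatMap-allFin : ∀ {A : Set} {k} (f : A → ℚ) (g : Fin k → List A) → listSum f (concatMap g (allFin k)) ≡ ∑ (λ i → listSum f (g i))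
  listSum-concatMap-allFin {k = k} f g = trans (listSum-concatMap f g (allFin k)) (listSum-allFin k (listSum f ∘ g))

  listSum-zero : ∀ {A : Set} {f : A → ℚ} xs → (∀ a → f a ≡ 0ℚ) → listSum f xs ≡ 0ℚ
  listSum-zero []       f≡0 = refl
  listSum-zero (x ∷ xs) f≡0 = trans (cong₂ _+_ (f≡0 x) (listSum-zero xs f≡0)) (ℚ.+-identityˡ 0ℚ)

  -- The certificate polynomial

  fromℕ : ℕ → ℚ
  fromℕ n = n · 1ℚ

  fromℕ-nonNegative : ∀ n → ℚ.NonNegative (fromℕ n)
  fromℕ-nonNegative ℕ.zero    = _
  fromℕ-nonNegative (ℕ.suc n) = ℚ.nonNeg+nonNeg⇒nonNeg 1ℚ (fromℕ n) {{fromℕ-nonNegative n}}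

  fromℕ-positive : ∀ n → .{{ℕ.NonZero n}} → ℚ.Positive (fromℕ n)
  fromℕ-positive (ℕ.suc n) = ℚ.pos+nonNeg⇒pos 1ℚ (fromℕ n) {{fromℕ-nonNegative n}}

  monomial : ∀ {m} → (Fin m → ℚ) → Subset m → ℚ
  monomial h S = ∏ (λ t → if lookup S t then h t else 1ℚ)

  Ψ : ∀ {m} → (ℕ → ℚ) → (Fin m → ℚ) → ℚ
  Ψ w h = ∑ (λ S → w ∣ S ∣ * monomial h S)

  absent : ∀ {m} → Subset m → Fin m → ℚ
  absent S j = if lookup S j then 0ℚ else 1ℚ

  D : ∀ {m} → (ℕ → ℚ) → (Fin m → ℚ) → Fin m → ℚ
  D w h j = ∑ (λ S → w (ℕ.suc ∣ S ∣) * (absent S j * monomial h S))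

  module _ {m} (w : ℕ → ℚ) (h : Fin (ℕ.suc m) → ℚ) where
    private
      h₀ = h zero
      h′ = h ∘ suc

    Ψ-suc : Ψ w h ≡ Ψ w h′ + h₀ * Ψ (w ∘ ℕ.suc) h′
    Ψ-suc = begin
      Ψ w h
        ≡⟨ Sums.big-Subset-suc (λ S → w ∣ S ∣ * monomial h S) ⟩
      ∑ (λ S → w ∣ S ∣ * (1ℚ * monomial h′ S)) + ∑ (λ S → w (ℕ.suc ∣ S ∣) * (h₀ * monomial h′ S))
        ≡⟨ cong₂ _+_ (Sums.big-cong (λ S → cong (w ∣ S ∣ *_) (ℚ.*-identityˡ (monomial h′ S))))
                     (Sums.big-cong (λ S → x∙yz≈y∙xz (w (ℕ.suc ∣ S ∣)) h₀ (monomial h′ S))) ⟩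
      Ψ w h′ + ∑ (λ S → h₀ * (w (ℕ.suc ∣ S ∣) * monomial h′ S))
        ≡⟨ cong (Ψ w h′ +_) (∑-*ˡ h₀ (λ S → w (ℕ.suc ∣ S ∣) * monomial h′ S)) ⟩
      Ψ w h′ + h₀ * Ψ (w ∘ ℕ.suc) h′ ∎

    D-zero : D w h zero ≡ Ψ (w ∘ ℕ.suc) h′
    D-zero = begin
      D w h zero
        ≡⟨ Sums.big-Subset-suc (λ S → w (ℕ.suc ∣ S ∣) * (absent S zero * monomial h S)) ⟩
      ∑ (λ S → w (ℕ.suc ∣ S ∣) * (1ℚ * (1ℚ * monomial h′ S)))
        + ∑ (λ S → w (ℕ.suc (ℕ.suc ∣ S ∣)) * (0ℚ * (h₀ * monomial h′ S)))
        ≡⟨ cong₂ _+_ (Sums.big-cong (λ S → drop-ones (w (ℕ.suc ∣ S ∣)) (monomial h′ S)))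
                     (trans (Sums.big-cong (λ S → vanish (w (ℕ.suc (ℕ.suc ∣ S ∣))) h₀ (monomial h′ S))) (Sums.big-ε (Subset m))) ⟩
      Ψ (w ∘ ℕ.suc) h′ + 0ℚ
        ≡⟨ ℚ.+-identityʳ _ ⟩
      Ψ (w ∘ ℕ.suc) h′ ∎
      where
      drop-ones : ∀ a x → a * (1ℚ * (1ℚ * x)) ≡ a * x
      drop-ones = solve-∀ ℚ-ring
      vanish : ∀ a b x → a * (0ℚ * (b * x)) ≡ 0ℚ
      vanish = solve-∀ ℚ-ring

    D-suc : ∀ j → D w h (suc j) ≡ D w h′ j + h₀ * D (w ∘ ℕ.suc) h′ j
    D-suc j = begin
      D w h (suc j)
        ≡⟨ Sums.big-Subset-suc (λ S → w (ℕ.suc ∣ S ∣) * (absent S (suc j) * monomial h S)) ⟩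
      ∑ (λ S → w (ℕ.suc ∣ S ∣) * (absent S j * (1ℚ * monomial h′ S)))
        + ∑ (λ S → w (ℕ.suc (ℕ.suc ∣ S ∣)) * (absent S j * (h₀ * monomial h′ S)))
        ≡⟨ cong₂ _+_ (Sums.big-cong (λ S → drop-one (w (ℕ.suc ∣ S ∣)) (absent S j) (monomial h′ S)))
                     (Sums.big-cong (λ S → pull-out (w (ℕ.suc (ℕ.suc ∣ S ∣))) (absent S j) h₀ (monomial h′ S))) ⟩
      D w h′ j + ∑ (λ S → h₀ * (w (ℕ.suc (ℕ.suc ∣ S ∣)) * (absent S j * monomial h′ S)))
        ≡⟨ cong (D w h′ j +_) (∑-*ˡ h₀ (λ S → w (ℕ.suc (ℕ.suc ∣ S ∣)) * (absent S j * monomial h′ S))) ⟩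
      D w h′ j + h₀ * D (w ∘ ℕ.suc) h′ j ∎
      where
      drop-one : ∀ a z x → a * (z * (1ℚ * x)) ≡ a * (z * x)
      drop-one = solve-∀ ℚ-ring
      pull-out : ∀ a z b x → a * (z * (b * x)) ≡ b * (a * (z * x))
      pull-out = solve-∀ ℚ-ring

  Ψ-+ : ∀ {m} (f g : ℕ → ℚ) (h : Fin m → ℚ) → Ψ (λ k → f k + g k) h ≡ Ψ f h + Ψ g h
  Ψ-+ f g h = trans (Sums.big-cong (λ S → ℚ.*-distribʳ-+ (monomial h S) (f ∣ S ∣) (g ∣ S ∣)))
                    (∑-+ (λ S → f ∣ S ∣ * monomial h S) (λ S → g ∣ S ∣ * monomial h S))

  Ψ-cong-≤ : ∀ {m} {f g : ℕ → ℚ} (h : Fin m → ℚ) → (∀ k → k ℕ.≤ m → f k ≡ g k) → Ψ f h ≡ Ψ g h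
  Ψ-cong-≤ h f≡g = Sums.big-cong (λ S → cong (_* monomial h S) (f≡g ∣ S ∣ (∣p∣≤n S)))

  δ₀ : ℕ → ℚ
  δ₀ ℕ.zero    = 1ℚ
  δ₀ (ℕ.suc _) = 0ℚ

  Ψ-δ₀ : ∀ {m} (h : Fin m → ℚ) → Ψ δ₀ h ≡ 1ℚ
  Ψ-δ₀ {ℕ.zero}  h = refl
  Ψ-δ₀ {ℕ.suc m} h = begin
    Ψ δ₀ h                                              ≡⟨ Ψ-suc δ₀ h ⟩
    Ψ δ₀ (h ∘ suc) + h zero * Ψ (λ _ → 0ℚ) (h ∘ suc)    ≡⟨ cong₂ (λ p q → p + h zero * q) (Ψ-δ₀ (h ∘ suc)) Ψ-0 ⟩
    1ℚ + h zero * 0ℚ                                    ≡⟨ cong (1ℚ +_) (ℚ.*-zeroʳ (h zero)) ⟩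
    1ℚ + 0ℚ                                             ≡⟨ ℚ.+-identityʳ 1ℚ ⟩
    1ℚ                                                  ∎
    where
    Ψ-0 : Ψ (λ _ → 0ℚ) (h ∘ suc) ≡ 0ℚ
    Ψ-0 = trans (Sums.big-cong (λ S → ℚ.*-zeroˡ (monomial (h ∘ suc) S))) (Sums.big-ε (Subset m))

  collapse : (ℕ → ℚ) → ℕ → ℚ
  collapse w ℕ.zero    = 0ℚ
  collapse w (ℕ.suc k) = fromℕ (ℕ.suc k) * (w k + w (ℕ.suc k))

  collapse-suc : ∀ w k → collapse w (ℕ.suc k) ≡ collapse (w ∘ ℕ.suc) k + w k + w (ℕ.suc k)
  collapse-suc w ℕ.zero    = one-step (w 0) (w 1)
    where
    one-step : ∀ a b → (1ℚ + 0ℚ) * (a + b) ≡ 0ℚ + a + b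
    one-step = solve-∀ ℚ-ring
  collapse-suc w (ℕ.suc k) = peel (fromℕ (ℕ.suc k)) (w (ℕ.suc k)) (w (ℕ.suc (ℕ.suc k)))
    where
    peel : ∀ n a b → (1ℚ + n) * (a + b) ≡ n * (a + b) + a + b
    peel = solve-∀ ℚ-ring

  D-identity : ∀ {m} (w : ℕ → ℚ) (h : Fin m → ℚ) →
    ∑ (λ j → (h j * h j - h j) * D w h j) ≡ ∑ h * Ψ w h - Ψ (collapse w) h
  D-identity {ℕ.zero}  w h = empty (w 0)
    where
    empty : ∀ a → 0ℚ ≡ 0ℚ * (a * 1ℚ + 0ℚ) - (0ℚ * 1ℚ + 0ℚ)
    empty = solve-∀ ℚ-ring
  D-identity {ℕ.suc m} w h = begin
    (h₀ * h₀ - h₀) * D w h zero + ∑ (λ j → u j * D w h (suc j))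
      ≡⟨ cong₂ _+_ (cong ((h₀ * h₀ - h₀) *_) (D-zero w h))
                   (Sums.big-cong (λ j → cong (u j *_) (D-suc w h j))) ⟩
    (h₀ * h₀ - h₀) * Ψ₁ + ∑ (λ j → u j * (D w h′ j + h₀ * D (w ∘ ℕ.suc) h′ j))
      ≡⟨ cong ((h₀ * h₀ - h₀) * Ψ₁ +_) split ⟩
    (h₀ * h₀ - h₀) * Ψ₁ + (∑ (λ j → u j * D w h′ j) + h₀ * ∑ (λ j → u j * D (w ∘ ℕ.suc) h′ j))
      ≡⟨ cong₂ (λ p q → (h₀ * h₀ - h₀) * Ψ₁ + (p + h₀ * q)) (D-identity w h′) (D-identity (w ∘ ℕ.suc) h′) ⟩
    (h₀ * h₀ - h₀) * Ψ₁ + ((s′ * Ψ₀ - C₀) + h₀ * (s′ * Ψ₁ - C₁))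
      ≡⟨ regroup h₀ s′ Ψ₀ Ψ₁ C₀ C₁ ⟩
    (h₀ + s′) * (Ψ₀ + h₀ * Ψ₁) - (C₀ + h₀ * (C₁ + Ψ₀ + Ψ₁))
      ≡⟨ cong₂ (λ p c → (h₀ + s′) * p - c) (sym (Ψ-suc w h)) (sym collapse-split) ⟩
    ∑ h * Ψ w h - Ψ (collapse w) h ∎
    where
    h₀ = h zero
    h′ = h ∘ suc
    s′ = ∑ h′
    u : Fin m → ℚ
    u j = h′ j * h′ j - h′ j
    Ψ₀ = Ψ w h′
    Ψ₁ = Ψ (w ∘ ℕ.suc) h′
    C₀ = Ψ (collapse w) h′
    C₁ = Ψ (collapse (w ∘ ℕ.suc)) h′

    regroup : ∀ a s p q c d → (a * a - a) * q + ((s * p - c) + a * (s * q - d)) ≡ (a + s) * (p + a * q) - (c + a * (d + p + q))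
    regroup = solve-∀ ℚ-ring

    distribute : ∀ u x a y → u * (x + a * y) ≡ u * x + a * (u * y)
    distribute = solve-∀ ℚ-ring

    split : ∑ (λ j → u j * (D w h′ j + h₀ * D (w ∘ ℕ.suc) h′ j))
          ≡ ∑ (λ j → u j * D w h′ j) + h₀ * ∑ (λ j → u j * D (w ∘ ℕ.suc) h′ j)
    split = begin
      ∑ (λ j → u j * (D w h′ j + h₀ * D (w ∘ ℕ.suc) h′ j))
        ≡⟨ Sums.big-cong (λ j → distribute (u j) (D w h′ j) h₀ (D (w ∘ ℕ.suc) h′ j)) ⟩
      ∑ (λ j → u j * D w h′ j + h₀ * (u j * D (w ∘ ℕ.suc) h′ j))
        ≡⟨ ∑-+ (λ j → u j * D w h′ j) (λ j → h₀ * (u j * D (w ∘ ℕ.suc) h′ j)) ⟩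
      ∑ (λ j → u j * D w h′ j) + ∑ (λ j → h₀ * (u j * D (w ∘ ℕ.suc) h′ j))
        ≡⟨ cong (∑ (λ j → u j * D w h′ j) +_) (∑-*ˡ h₀ (λ j → u j * D (w ∘ ℕ.suc) h′ j)) ⟩
      ∑ (λ j → u j * D w h′ j) + h₀ * ∑ (λ j → u j * D (w ∘ ℕ.suc) h′ j) ∎

    collapse-split : Ψ (collapse w) h ≡ C₀ + h₀ * (C₁ + Ψ₀ + Ψ₁)
    collapse-split = begin
      Ψ (collapse w) h
        ≡⟨ Ψ-suc (collapse w) h ⟩
      C₀ + h₀ * Ψ (collapse w ∘ ℕ.suc) h′
        ≡⟨ cong (λ p → C₀ + h₀ * p) (trans (Sums.big-cong (λ S → cong (_* monomial h′ S) (collapse-suc w ∣ S ∣)))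
                                    (trans (Ψ-+ (λ k → collapse (w ∘ ℕ.suc) k + w k) (w ∘ ℕ.suc) h′)
                                           (cong (_+ Ψ₁) (Ψ-+ (collapse (w ∘ ℕ.suc)) w h′)))) ⟩
      C₀ + h₀ * (C₁ + Ψ₀ + Ψ₁) ∎

  Ψ-linear : ∀ {m} a (f g : ℕ → ℚ) (h : Fin m → ℚ) → Ψ (λ k → a * f k - g k) h ≡ a * Ψ f h - Ψ g h
  Ψ-linear a f g h = begin
    Ψ (λ k → a * f k - g k) h
      ≡⟨ Sums.big-cong (λ S → expand a (f ∣ S ∣) (g ∣ S ∣) (monomial h S)) ⟩
    ∑ (λ S → a * (f ∣ S ∣ * monomial h S) + (- 1ℚ) * (g ∣ S ∣ * monomial h S))
      ≡⟨ ∑-+ (λ S → a * (f ∣ S ∣ * monomial h S)) (λ S → (- 1ℚ) * (g ∣ S ∣ * monomial h S)) ⟩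
    ∑ (λ S → a * (f ∣ S ∣ * monomial h S)) + ∑ (λ S → (- 1ℚ) * (g ∣ S ∣ * monomial h S))
      ≡⟨ cong₂ _+_ (∑-*ˡ a (λ S → f ∣ S ∣ * monomial h S)) (∑-*ˡ (- 1ℚ) (λ S → g ∣ S ∣ * monomial h S)) ⟩
    a * Ψ f h + (- 1ℚ) * Ψ g h
      ≡⟨ contract (a * Ψ f h) (Ψ g h) ⟩
    a * Ψ f h - Ψ g h ∎
    where
    expand : ∀ a x y z → (a * x - y) * z ≡ a * (x * z) + (- 1ℚ) * (y * z)
    expand = solve-∀ ℚ-ring
    contract : ∀ x y → x + (- 1ℚ) * y ≡ x - y
    contract = solve-∀ ℚ-ring

  fromℕ-nonZero : ∀ n → .{{ℕ.NonZero n}} → ℚ.NonZero (fromℕ n)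
  fromℕ-nonZero n = ℚ.pos⇒nonZero (fromℕ n) {{fromℕ-positive n}}

  fromℕ-cancel : ∀ {p q r} → p ≡ q ℕ.+ r → fromℕ p - (fromℕ q + fromℕ r) ≡ 0ℚ
  fromℕ-cancel {q = q} {r} refl = trans (cong (_- (fromℕ q + fromℕ r)) (×-homo-+ 1ℚ q r)) (ℚ.+-inverseʳ (fromℕ q + fromℕ r))

  factorial⁻¹ : ℕ → ℚ
  factorial⁻¹ n = (1/ fromℕ (n !)) {{fromℕ-nonZero (n !) {{n !≢0}}}}

  factorial⁻¹-inverse : ∀ n → fromℕ (n !) * factorial⁻¹ n ≡ 1ℚ
  factorial⁻¹-inverse n = ℚ.*-inverseʳ (fromℕ (n !)) {{fromℕ-nonZero (n !) {{n !≢0}}}}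

  weight : ℕ → ℕ → ℚ
  weight m k = fromℕ (k ! ℕ.* (m ℕ.∸ k) !) * factorial⁻¹ (ℕ.suc m)

  -- For 1 ≤ k ≤ m the balance reads (m+1−k) w(k) = k w(k−1); both sides equal k! (m+1−k)! / (m+1)!.
  weight-balance : ∀ m k → k ℕ.≤ m → fromℕ (ℕ.suc m) * weight m k - collapse (weight m) k ≡ δ₀ k
  weight-balance m ℕ.zero _ = begin
    fromℕ (ℕ.suc m) * (fromℕ (1 ℕ.* m !) * r) - 0ℚ   ≡⟨ reassoc (fromℕ (ℕ.suc m)) (fromℕ (1 ℕ.* m !)) r ⟩
    fromℕ (ℕ.suc m) * fromℕ (1 ℕ.* m !) * r         ≡⟨ cong (_* r) (sym (×1-homo-* (ℕ.suc m) (1 ℕ.* m !))) ⟩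
    fromℕ (ℕ.suc m ℕ.* (1 ℕ.* m !)) * r             ≡⟨ cong (λ n → fromℕ (ℕ.suc m ℕ.* n) * r) (ℕ.*-identityˡ (m !)) ⟩
    fromℕ (ℕ.suc m !) * r                           ≡⟨ factorial⁻¹-inverse (ℕ.suc m) ⟩
    1ℚ                                              ∎
    where
    r = factorial⁻¹ (ℕ.suc m)
    reassoc : ∀ a b c → a * (b * c) - 0ℚ ≡ a * b * c
    reassoc = solve-∀ ℚ-ring
  weight-balance m (ℕ.suc k) k<m =
    subst (λ m → fromℕ (ℕ.suc m) * weight m (ℕ.suc k) - collapse (weight m) (ℕ.suc k) ≡ 0ℚ)
          (ℕ.m+[n∸m]≡n k<m) (balance (m ℕ.∸ ℕ.suc k))
    where
    balance : ∀ j → let m = ℕ.suc k ℕ.+ j in fromℕ (ℕ.suc m) * weight m (ℕ.suc k) - collapse (weight m) (ℕ.suc k) ≡ 0ℚ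
    balance j rewrite ℕ.m+n∸m≡n k j | trans (cong (ℕ._∸ k) (sym (ℕ.+-suc k j))) (ℕ.m+n∸m≡n k (ℕ.suc j)) = begin
      fromℕ m+1 * (fromℕ A * r) - fromℕ (ℕ.suc k) * (fromℕ B * r + fromℕ A * r)
        ≡⟨ factor-out (fromℕ m+1) (fromℕ A) (fromℕ (ℕ.suc k)) (fromℕ B) r ⟩
      (fromℕ m+1 * fromℕ A - (fromℕ (ℕ.suc k) * fromℕ B + fromℕ (ℕ.suc k) * fromℕ A)) * r
        ≡⟨ cong (_* r) (sym (cong₂ (λ x y → x - y) (×1-homo-* m+1 A) (cong₂ _+_ (×1-homo-* (ℕ.suc k) B) (×1-homo-* (ℕ.suc k) A)))) ⟩
      (fromℕ (m+1 ℕ.* A) - (fromℕ (ℕ.suc k ℕ.* B) + fromℕ (ℕ.suc k ℕ.* A))) * r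
        ≡⟨ cong (_* r) (fromℕ-cancel {m+1 ℕ.* A} {ℕ.suc k ℕ.* B} {ℕ.suc k ℕ.* A} (factorials k j (k !) (j !))) ⟩
      0ℚ * r
        ≡⟨ ℚ.*-zeroˡ r ⟩
      0ℚ ∎
      where
      m+1 = ℕ.suc (ℕ.suc k ℕ.+ j)
      A = ℕ.suc k ! ℕ.* j !
      B = k ! ℕ.* ℕ.suc j !
      r = factorial⁻¹ m+1
      factor-out : ∀ x a s b r → x * (a * r) - s * (b * r + a * r) ≡ (x * a - (s * b + s * a)) * r
      factor-out = solve-∀ ℚ-ring
      factorials : ∀ k j K J → ℕ.suc (ℕ.suc k ℕ.+ j) ℕ.* ((ℕ.suc k ℕ.* K) ℕ.* J)
                 ≡ ℕ.suc k ℕ.* (K ℕ.* (ℕ.suc j ℕ.* J)) ℕ.+ ℕ.suc k ℕ.* ((ℕ.suc k ℕ.* K) ℕ.* J)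
      factorials = ℕ-solve-∀

  certificate-identity : ∀ {m} (h : Fin m → ℚ) →
    ∑ (λ j → (h j * h j - h j) * D (weight m) h j) - (∑ h - fromℕ (ℕ.suc m)) * Ψ (weight m) h ≡ 1ℚ
  certificate-identity {m} h = begin
    ∑ (λ j → (h j * h j - h j) * D w h j) - (s - N) * Ψ w h
      ≡⟨ cong (_- (s - N) * Ψ w h) (D-identity w h) ⟩
    (s * Ψ w h - Ψ (collapse w) h) - (s - N) * Ψ w h
      ≡⟨ cancel s (Ψ w h) (Ψ (collapse w) h) N ⟩
    N * Ψ w h - Ψ (collapse w) h
      ≡⟨ sym (Ψ-linear N w (collapse w) h) ⟩
    Ψ (λ k → N * w k - collapse w k) h
      ≡⟨ Ψ-cong-≤ h (weight-balance m) ⟩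
    Ψ δ₀ h
      ≡⟨ Ψ-δ₀ h ⟩
    1ℚ ∎
    where
    w = weight m
    s = ∑ h
    N = fromℕ (ℕ.suc m)
    cancel : ∀ s p c n → (s * p - c) - (s - n) * p ≡ n * p - c
    cancel = solve-∀ ℚ-ring

  -- The symmetric circuit

  module PHP-Certificate (n : ℕ) where

    Pigeon Hole : Set
    Pigeon = Fin (ℕ.suc n)
    Hole   = Fin n

    -- Inputs: x_ij, y_{bool,i,j}, y_{hole,j,{i,i′}} for every ordered pair (i, i′) (so every unordered pair
    -- twice, and 0 on the diagonal), y_{row,i}, and the constants w(|S|+1), −w(|S|) and 0. Sums: h_j, B_j, R.
    -- Products: T_{j,S} = w(|S|+1) [j ∉ S] h^S B_j and U_S = −w(|S|) h^S R. Output: Σ T + Σ U.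
    InputGate SumGate ProductGate Gate : Set
    InputGate   = Pigeon × Hole ⊎ Pigeon × Hole ⊎ Hole × Pigeon × Pigeon ⊎ Pigeon ⊎ Subset n ⊎ Subset n ⊎ ⊤
    SumGate     = Hole ⊎ Hole ⊎ ⊤
    ProductGate = Hole × Subset n ⊎ Subset n
    Gate        = InputGate ⊎ SumGate ⊎ ProductGate ⊎ ⊤

    pattern x-gate i j          = inj₁ (inj₁ (i , j))
    pattern ybool-gate i j      = inj₁ (inj₂ (inj₁ (i , j)))
    pattern yhole-gate j i i′   = inj₁ (inj₂ (inj₂ (inj₁ (j , i , i′))))
    pattern yrow-gate i         = inj₁ (inj₂ (inj₂ (inj₂ (inj₁ i))))
    pattern weight-gate S       = inj₁ (inj₂ (inj₂ (inj₂ (inj₂ (inj₁ S)))))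
    pattern neg-weight-gate S   = inj₁ (inj₂ (inj₂ (inj₂ (inj₂ (inj₂ (inj₁ S))))))
    pattern zero-gate           = inj₁ (inj₂ (inj₂ (inj₂ (inj₂ (inj₂ (inj₂ tt))))))
    pattern h-gate j            = inj₂ (inj₁ (inj₁ j))
    pattern B-gate j            = inj₂ (inj₁ (inj₂ (inj₁ j)))
    pattern R-gate              = inj₂ (inj₁ (inj₂ (inj₂ tt)))
    pattern T-gate j S          = inj₂ (inj₂ (inj₁ (inj₁ (j , S))))
    pattern U-gate S            = inj₂ (inj₂ (inj₁ (inj₂ S)))
    pattern out-gate            = inj₂ (inj₂ (inj₂ tt))

    hole-label : Hole → Pigeon → Pigeon → Label (Var n)
    hole-label j i i′ with <-cmp i i′
    ... | tri< i<i′ _ _ = var (inj₂ (hole j i i′ i<i′))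
    ... | tri≈ _ _ _    = const 0ℚ
    ... | tri> _ _ i′<i = var (inj₂ (hole j i′ i i′<i))

    label : Gate → Label (Var n)
    label (x-gate i j)        = var (inj₁ (i , j))
    label (ybool-gate i j)    = var (inj₂ (bool i j))
    label (yhole-gate j i i′) = hole-label j i i′
    label (yrow-gate i)       = var (inj₂ (row i))
    label (weight-gate S)     = const (weight n (ℕ.suc ∣ S ∣))
    label (neg-weight-gate S) = const (- weight n ∣ S ∣)
    label zero-gate           = const 0ℚ
    label (h-gate _)          = plus
    label (B-gate _)          = plus
    label R-gate              = plus
    label (T-gate _ _)        = times
    label (U-gate _)          = times
    label out-gate            = plus

    edge : Gate → Gate → Bool
    edge (h-gate j)   (x-gate i j′)        = does (j Fin.≟ j′)
    edge (B-gate j)   (ybool-gate i j′)    = does (j Fin.≟ j′)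
    edge (B-gate j)   (yhole-gate j′ i i′) = does (j Fin.≟ j′)
    edge R-gate       (yrow-gate i)        = true
    edge (T-gate j S) (weight-gate S′)     = does (S ≟ˢ S′)
    edge (T-gate j S) zero-gate            = lookup S j
    edge (T-gate j S) (h-gate t)           = lookup S t
    edge (T-gate j S) (B-gate j′)          = does (j Fin.≟ j′)
    edge (U-gate S)   (neg-weight-gate S′) = does (S ≟ˢ S′)
    edge (U-gate S)   (h-gate t)           = lookup S t
    edge (U-gate S)   R-gate               = true
    edge out-gate     (T-gate j S)         = true
    edge out-gate     (U-gate S)           = true
    edge _            _                    = false

    private
      input<above : ∀ (c : InputGate) (u : SumGate ⊎ ProductGate ⊎ ⊤) → encode {Gate} (inj₁ c) Fin.< encode {Gate} (inj₂ u)
      input<above = encode-inj₁<inj₂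

      sum<above : ∀ (c : SumGate) (u : ProductGate ⊎ ⊤) → encode {Gate} (inj₂ (inj₁ c)) Fin.< encode {Gate} (inj₂ (inj₂ u))
      sum<above c u = encode-inj₂-mono {A = InputGate} (inj₁ c) (inj₂ u) (encode-inj₁<inj₂ c u)

      product<output : ∀ (c : ProductGate) → encode {Gate} (inj₂ (inj₂ (inj₁ c))) Fin.< encode {Gate} out-gate
      product<output c = encode-inj₂-mono {A = InputGate} {B = SumGate ⊎ ProductGate ⊎ ⊤} (inj₂ (inj₁ c)) (inj₂ (inj₂ tt))
                           (encode-inj₂-mono {A = SumGate} (inj₁ c) (inj₂ tt) (encode-inj₁<inj₂ c tt))

    edge-descends : ∀ a b → edge a b ≡ true → encode b Fin.< encode a
    edge-descends (inj₁ _)                (_)                     ()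
    edge-descends (inj₂ (inj₁ p))         (inj₁ c)                _  = input<above c (inj₁ p)
    edge-descends (h-gate _)              (inj₂ _)                ()
    edge-descends (B-gate _)              (inj₂ _)                ()
    edge-descends R-gate                  (inj₂ _)                ()
    edge-descends (inj₂ (inj₂ (inj₁ p)))  (inj₁ c)                _  = input<above c (inj₂ (inj₁ p))
    edge-descends (inj₂ (inj₂ (inj₁ p)))  (inj₂ (inj₁ c))         _  = sum<above c (inj₁ p)
    edge-descends (T-gate _ _)            (inj₂ (inj₂ _))         ()
    edge-descends (U-gate _)              (inj₂ (inj₂ _))         ()
    edge-descends out-gate                (inj₁ _)                ()
    edge-descends out-gate                (inj₂ (inj₁ _))         ()
    edge-descends out-gate                (inj₂ (inj₂ (inj₁ c)))  _  = product<output c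
    edge-descends out-gate                (inj₂ (inj₂ (inj₂ _)))  ()

    inputs-are-leaves : ∀ a → IsInput (label a) → ∀ b → edge a b ≡ false
    inputs-are-leaves (inj₁ _)     _  _ = refl
    inputs-are-leaves (h-gate _)   ()
    inputs-are-leaves (B-gate _)   ()
    inputs-are-leaves R-gate       ()
    inputs-are-leaves (T-gate _ _) ()
    inputs-are-leaves (U-gate _)   ()
    inputs-are-leaves out-gate     ()

    output-is-sink : ∀ a → edge a out-gate ≡ false
    output-is-sink (inj₁ _)     = refl
    output-is-sink (h-gate _)   = refl
    output-is-sink (B-gate _)   = refl
    output-is-sink R-gate       = refl
    output-is-sink (T-gate _ _) = refl
    output-is-sink (U-gate _)   = refl
    output-is-sink out-gate     = refl

    -- The constant gates w(|S|+1) and 0 only feed T-gates, so a hole j₀ is needed.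
    has-parent : Hole → ∀ b → b ≢ out-gate → ∃ λ a → edge a b ≡ true
    has-parent j₀ (x-gate i j)        _ = h-gate j , dec-true (j Fin.≟ j) refl
    has-parent j₀ (ybool-gate i j)    _ = B-gate j , dec-true (j Fin.≟ j) refl
    has-parent j₀ (yhole-gate j i i′) _ = B-gate j , dec-true (j Fin.≟ j) refl
    has-parent j₀ (yrow-gate i)       _ = R-gate , refl
    has-parent j₀ (weight-gate S)     _ = T-gate j₀ S , dec-true (S ≟ˢ S) refl
    has-parent j₀ (neg-weight-gate S) _ = U-gate S , dec-true (S ≟ˢ S) refl
    has-parent j₀ zero-gate           _ = T-gate j₀ (Vec.replicate n true) , VecP.lookup-replicate j₀ true
    has-parent j₀ (h-gate t)          _ = U-gate (Vec.replicate n true) , VecP.lookup-replicate t true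
    has-parent j₀ (B-gate j)          _ = T-gate j (Vec.replicate n false) , dec-true (j Fin.≟ j) refl
    has-parent j₀ R-gate              _ = U-gate (Vec.replicate n false) , refl
    has-parent j₀ (T-gate _ _)        _ = out-gate , refl
    has-parent j₀ (U-gate _)          _ = out-gate , refl
    has-parent j₀ out-gate            b≢out = ⊥-elim (b≢out refl)

    php-finite-circuit : ⦃ _ : ℕ.NonZero n ⦄ → FiniteCircuit (Var n)
    php-finite-circuit = record
      { Gate              = Gate
      ; label             = label
      ; edge              = edge
      ; output            = out-gate
      ; edge-descends     = edge-descends
      ; inputs-are-leaves = inputs-are-leaves
      ; output-is-sink    = output-is-sink
      ; has-parent        = has-parent (Fin.fromℕ< (ℕ.>-nonZero⁻¹ n))
      }

    php-circuit : ⦃ _ : ℕ.NonZero n ⦄ → Circuit (Var n)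
    php-circuit = FiniteCircuit.circuit php-finite-circuit

    -- Written with Sum.map, so that act-gate g (inj₂ c) reduces for a variable c; this keeps the case
    -- analyses of act-gate-edge short.
    act-gate : SymGroup n → Gate → Gate
    act-gate (π , σ) = act-input ⊎ᶠ act-sum ⊎ᶠ act-product ⊎ᶠ id
      where
      act-input : InputGate → InputGate
      act-input = (π ⟨$⟩ʳ_) ×ᶠ (σ ⟨$⟩ʳ_) ⊎ᶠ (π ⟨$⟩ʳ_) ×ᶠ (σ ⟨$⟩ʳ_) ⊎ᶠ (σ ⟨$⟩ʳ_) ×ᶠ (π ⟨$⟩ʳ_) ×ᶠ (π ⟨$⟩ʳ_)
                ⊎ᶠ (π ⟨$⟩ʳ_) ⊎ᶠ permute σ ⊎ᶠ permute σ ⊎ᶠ id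
      act-sum : SumGate → SumGate
      act-sum = (σ ⟨$⟩ʳ_) ⊎ᶠ (σ ⟨$⟩ʳ_) ⊎ᶠ id
      act-product : ProductGate → ProductGate
      act-product = (σ ⟨$⟩ʳ_) ×ᶠ permute σ ⊎ᶠ permute σ

    _⁻¹ : SymGroup n → SymGroup n
    (π , σ) ⁻¹ = flip π , flip σ

    act-gate-inverse : ∀ g a → act-gate (g ⁻¹) (act-gate g a) ≡ a
    act-gate-inverse (π , σ) (x-gate i j)        = cong₂ (λ i j → x-gate i j) (inverseˡ π) (inverseˡ σ)
    act-gate-inverse (π , σ) (ybool-gate i j)    = cong₂ (λ i j → ybool-gate i j) (inverseˡ π) (inverseˡ σ)
    act-gate-inverse (π , σ) (yhole-gate j i i′) =
      cong₂ (λ j (i , i′) → yhole-gate j i i′) (inverseˡ σ) (cong₂ _,_ (inverseˡ π) (inverseˡ π))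
    act-gate-inverse (π , σ) (yrow-gate i)       = cong (λ i → yrow-gate i) (inverseˡ π)
    act-gate-inverse (π , σ) (weight-gate S)     = cong (λ S → weight-gate S) (permute-inverse σ S)
    act-gate-inverse (π , σ) (neg-weight-gate S) = cong (λ S → neg-weight-gate S) (permute-inverse σ S)
    act-gate-inverse (π , σ) zero-gate           = refl
    act-gate-inverse (π , σ) (h-gate j)          = cong (λ j → h-gate j) (inverseˡ σ)
    act-gate-inverse (π , σ) (B-gate j)          = cong (λ j → B-gate j) (inverseˡ σ)
    act-gate-inverse (π , σ) R-gate              = refl
    act-gate-inverse (π , σ) (T-gate j S)        = cong₂ (λ j S → T-gate j S) (inverseˡ σ) (permute-inverse σ S)
    act-gate-inverse (π , σ) (U-gate S)          = cong (λ S → U-gate S) (permute-inverse σ S)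
    act-gate-inverse (π , σ) out-gate            = refl

    gate-automorphism : SymGroup n → Gate ↔ Gate
    gate-automorphism g = mk↔ₛ′ (act-gate g) (act-gate (g ⁻¹)) (act-gate-inverse (g ⁻¹)) (act-gate-inverse g)

    hole-label-equivariant : ∀ π σ j i i′ →
      hole-label (σ ⟨$⟩ʳ j) (π ⟨$⟩ʳ i) (π ⟨$⟩ʳ i′) ≡ mapLabel (act (π , σ)) (hole-label j i i′)
    hole-label-equivariant π σ j i i′ with <-cmp i i′
    ... | tri< i<i′ _ _ with <-cmp (π ⟨$⟩ʳ i) (π ⟨$⟩ʳ i′)
    ...   | tri< _ _ _ = refl
    ...   | tri≈ _ πi≡πi′ _ = ⊥-elim (<-irrefl (perm-inj π πi≡πi′) i<i′)
    ...   | tri> _ _ _ = refl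
    hole-label-equivariant π σ j i i′ | tri≈ _ i≡i′ _ with <-cmp (π ⟨$⟩ʳ i) (π ⟨$⟩ʳ i′)
    ...   | tri< _ πi≢πi′ _ = ⊥-elim (πi≢πi′ (cong (π ⟨$⟩ʳ_) i≡i′))
    ...   | tri≈ _ _ _ = refl
    ...   | tri> _ πi≢πi′ _ = ⊥-elim (πi≢πi′ (cong (π ⟨$⟩ʳ_) i≡i′))
    hole-label-equivariant π σ j i i′ | tri> _ _ i′<i with <-cmp (π ⟨$⟩ʳ i) (π ⟨$⟩ʳ i′) | <-cmp (π ⟨$⟩ʳ i′) (π ⟨$⟩ʳ i)
    ...   | tri< p _ _ | tri> _ _ q = cong (λ r → var (inj₂ (hole (σ ⟨$⟩ʳ j) (π ⟨$⟩ʳ i) (π ⟨$⟩ʳ i′) r))) (<-irrelevant p q)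
    ...   | tri> _ _ p | tri< q _ _ = cong (λ r → var (inj₂ (hole (σ ⟨$⟩ʳ j) (π ⟨$⟩ʳ i′) (π ⟨$⟩ʳ i) r))) (<-irrelevant p q)
    ...   | tri< p _ _ | tri< q _ _ = ⊥-elim (<-asym p q)
    ...   | tri> _ _ p | tri> _ _ q = ⊥-elim (<-asym p q)
    ...   | tri≈ _ πi≡πi′ _ | _ = ⊥-elim (<-irrefl (perm-inj π (sym πi≡πi′)) i′<i)
    ...   | _ | tri≈ _ πi′≡πi _ = ⊥-elim (<-irrefl (perm-inj π πi′≡πi) i′<i)

    act-gate-label : ∀ g a → label (act-gate g a) ≡ mapLabel (act g) (label a)
    act-gate-label g       (x-gate i j)        = refl
    act-gate-label g       (ybool-gate i j)    = refl
    act-gate-label (π , σ) (yhole-gate j i i′) = hole-label-equivariant π σ j i i′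
    act-gate-label g       (yrow-gate i)       = refl
    act-gate-label (π , σ) (weight-gate S)     = cong (λ k → const (weight n (ℕ.suc k))) (∣permute∣ σ S)
    act-gate-label (π , σ) (neg-weight-gate S) = cong (λ k → const (- weight n k)) (∣permute∣ σ S)
    act-gate-label g       zero-gate           = refl
    act-gate-label g       (h-gate _)          = refl
    act-gate-label g       (B-gate _)          = refl
    act-gate-label g       R-gate              = refl
    act-gate-label g       (T-gate _ _)        = refl
    act-gate-label g       (U-gate _)          = refl
    act-gate-label g       out-gate            = refl

    T-gate-edge : ∀ g j S b → edge (act-gate g (T-gate j S)) (act-gate g b) ≡ edge (T-gate j S) b
    T-gate-edge g       j S (inj₁ (inj₁ _))               = refl
    T-gate-edge g       j S (inj₁ (inj₂ (inj₁ _)))        = refl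
    T-gate-edge g       j S (inj₁ (inj₂ (inj₂ (inj₁ _)))) = refl
    T-gate-edge g       j S (yrow-gate _)                 = refl
    T-gate-edge (π , σ) j S (weight-gate S′)              = does-≟ˢ-permute σ S S′
    T-gate-edge g       j S (neg-weight-gate _)           = refl
    T-gate-edge (π , σ) j S zero-gate                     = lookup-permute σ S j
    T-gate-edge (π , σ) j S (h-gate t)                    = lookup-permute σ S t
    T-gate-edge (π , σ) j S (B-gate j′)                   = does-≟-⟨$⟩ʳ σ j j′
    T-gate-edge g       j S R-gate                        = refl
    T-gate-edge g       j S (inj₂ (inj₂ _))               = refl

    U-gate-edge : ∀ g S b → edge (act-gate g (U-gate S)) (act-gate g b) ≡ edge (U-gate S) b
    U-gate-edge g       S (inj₁ (inj₁ _))               = refl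
    U-gate-edge g       S (inj₁ (inj₂ (inj₁ _)))        = refl
    U-gate-edge g       S (inj₁ (inj₂ (inj₂ (inj₁ _)))) = refl
    U-gate-edge g       S (yrow-gate _)                 = refl
    U-gate-edge g       S (weight-gate _)               = refl
    U-gate-edge (π , σ) S (neg-weight-gate S′)          = does-≟ˢ-permute σ S S′
    U-gate-edge g       S zero-gate                     = refl
    U-gate-edge (π , σ) S (h-gate t)                    = lookup-permute σ S t
    U-gate-edge g       S (B-gate _)                    = refl
    U-gate-edge g       S R-gate                        = refl
    U-gate-edge g       S (inj₂ (inj₂ _))               = refl

    act-gate-edge : ∀ g a b → edge (act-gate g a) (act-gate g b) ≡ edge a b
    act-gate-edge g       (inj₁ _)     b                                    = refl
    act-gate-edge (π , σ) (h-gate j)   (x-gate i j′)                        = does-≟-⟨$⟩ʳ σ j j′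
    act-gate-edge g       (h-gate j)   (inj₁ (inj₂ _))                      = refl
    act-gate-edge g       (h-gate j)   (inj₂ _)                             = refl
    act-gate-edge g       (B-gate j)   (inj₁ (inj₁ _))                      = refl
    act-gate-edge (π , σ) (B-gate j)   (ybool-gate i j′)                    = does-≟-⟨$⟩ʳ σ j j′
    act-gate-edge (π , σ) (B-gate j)   (yhole-gate j′ i i′)                 = does-≟-⟨$⟩ʳ σ j j′
    act-gate-edge g       (B-gate j)   (inj₁ (inj₂ (inj₂ (inj₂ _))))        = refl
    act-gate-edge g       (B-gate j)   (inj₂ _)                             = refl
    act-gate-edge g       R-gate       (inj₁ (inj₁ _))                      = refl
    act-gate-edge g       R-gate       (inj₁ (inj₂ (inj₁ _)))               = refl
    act-gate-edge g       R-gate       (inj₁ (inj₂ (inj₂ (inj₁ _))))        = refl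
    act-gate-edge g       R-gate       (yrow-gate _)                        = refl
    act-gate-edge g       R-gate       (inj₁ (inj₂ (inj₂ (inj₂ (inj₂ _))))) = refl
    act-gate-edge g       R-gate       (inj₂ _)                             = refl
    act-gate-edge g       (T-gate j S) b                                    = T-gate-edge g j S b
    act-gate-edge g       (U-gate S)   b                                    = U-gate-edge g S b
    act-gate-edge g       out-gate     (inj₁ _)                             = refl
    act-gate-edge g       out-gate     (inj₂ (inj₁ _))                      = refl
    act-gate-edge g       out-gate     (T-gate _ _)                         = refl
    act-gate-edge g       out-gate     (U-gate _)                           = refl
    act-gate-edge g       out-gate     (inj₂ (inj₂ (inj₂ _)))               = refl

    php-circuit-symmetric : ⦃ _ : ℕ.NonZero n ⦄ → Symmetric act php-circuit
    php-circuit-symmetric = FiniteCircuit.symmetric php-finite-circuit act gate-automorphism act-gate-edge act-gate-label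

    hole-label-is-input : ∀ j i i′ → IsInput (hole-label j i i′)
    hole-label-is-input j i i′ with <-cmp i i′
    ... | tri< _ _ _ = tt
    ... | tri≈ _ _ _ = tt
    ... | tri> _ _ _ = tt

    input-gate-is-input : ∀ c → IsInput (label (inj₁ c))
    input-gate-is-input (inj₁ _)                                   = tt
    input-gate-is-input (inj₂ (inj₁ _))                            = tt
    input-gate-is-input (inj₂ (inj₂ (inj₁ (j , i , i′))))          = hole-label-is-input j i i′
    input-gate-is-input (inj₂ (inj₂ (inj₂ (inj₁ _))))              = tt
    input-gate-is-input (inj₂ (inj₂ (inj₂ (inj₂ (inj₁ _)))))       = tt
    input-gate-is-input (inj₂ (inj₂ (inj₂ (inj₂ (inj₂ (inj₁ _)))))) = tt
    input-gate-is-input (inj₂ (inj₂ (inj₂ (inj₂ (inj₂ (inj₂ tt)))))) = tt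

    module Values ⦃ _ : ℕ.NonZero n ⦄ (ρ : Var n → ℚ) where

      h-value : Hole → ℚ
      h-value j = ∑ (λ i → ρ (inj₁ (i , j)))

      B-value : Hole → ℚ
      B-value j = ∑ (λ i → ρ (inj₂ (bool i j))) + ∑ (λ i → ∑ (λ i′ → input-value ρ (hole-label j i i′)))

      R-value : ℚ
      R-value = ∑ (λ i → ρ (inj₂ (row i)))

      T-value : Hole → Subset n → ℚ
      T-value j S = weight n (ℕ.suc ∣ S ∣) * absent S j * (monomial h-value S * B-value j)

      U-value : Subset n → ℚ
      U-value S = - weight n ∣ S ∣ * (monomial h-value S * R-value)

      output-value : ℚ
      output-value = ∑ (λ j → ∑ (T-value j)) + ∑ U-value

      value : Gate → ℚ
      value (inj₁ c)     = input-value ρ (label (inj₁ c))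
      value (h-gate j)   = h-value j
      value (B-gate j)   = B-value j
      value R-gate       = R-value
      value (T-gate j S) = T-value j S
      value (U-gate S)   = U-value S
      value out-gate     = output-value

      summands factors : Gate → Gate → ℚ
      summands a b = if edge a b then value b else 0ℚ
      factors  a b = if edge a b then value b else 1ℚ

      -- Each big-inj step drops a summand of the gate type containing no child: there the edge is false by
      -- computation, so the dropped terms are the unit by refl.
      h-children : ∀ j → ∑ (summands (h-gate j)) ≡ h-value j
      h-children j = begin
        ∑ F                                   ≡⟨ Sums.big-inj₁ F (λ _ → refl) ⟩
        ∑ (F ∘ inj₁)                          ≡⟨ Sums.big-inj₁ (F ∘ inj₁) (λ _ → refl) ⟩
        ∑ (F ∘ inj₁ ∘ inj₁)                   ≡⟨ Sums.big-× (F ∘ inj₁ ∘ inj₁) ⟩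
        ∑ (λ i → ∑ (λ j′ → F (x-gate i j′)))  ≡⟨ Sums.big-cong (λ i → Sums.big-δ Fin._≟_ j (λ j′ → ρ (inj₁ (i , j′)))) ⟩
        h-value j                             ∎
        where
        F = summands (h-gate j)

      B-children : ∀ j → ∑ (summands (B-gate j)) ≡ B-value j
      B-children j = begin
        ∑ F                                                  ≡⟨ Sums.big-inj₁ F (λ _ → refl) ⟩
        ∑ (F ∘ inj₁)                                         ≡⟨ Sums.big-inj₂ (F ∘ inj₁) (λ _ → refl) ⟩
        ∑ (F ∘ inj₁ ∘ inj₂)                                  ≡⟨ Sums.big-⊎ (F ∘ inj₁ ∘ inj₂) ⟩
        ∑ (F ∘ inj₁ ∘ inj₂ ∘ inj₁) + ∑ (F ∘ inj₁ ∘ inj₂ ∘ inj₂)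
          ≡⟨ cong₂ _+_ bool-part (trans (Sums.big-inj₁ (F ∘ inj₁ ∘ inj₂ ∘ inj₂) (λ _ → refl)) hole-part) ⟩
        B-value j ∎
        where
        F = summands (B-gate j)

        bool-part : ∑ (λ ((i , j′) : Pigeon × Hole) → F (ybool-gate i j′)) ≡ ∑ (λ i → ρ (inj₂ (bool i j)))
        bool-part = trans (Sums.big-× (λ (i , j′) → F (ybool-gate i j′)))
                          (Sums.big-cong (λ i → Sums.big-δ Fin._≟_ j (λ j′ → ρ (inj₂ (bool i j′)))))

        pair-sum : Hole → ℚ
        pair-sum j′ = ∑ (λ ((i , i′) : Pigeon × Pigeon) → input-value ρ (hole-label j′ i i′))

        hole-part : ∑ (λ ((j′ , i , i′) : Hole × Pigeon × Pigeon) → F (yhole-gate j′ i i′))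
                  ≡ ∑ (λ i → ∑ (λ i′ → input-value ρ (hole-label j i i′)))
        hole-part = begin
          ∑ (λ ((j′ , i , i′) : Hole × Pigeon × Pigeon) → F (yhole-gate j′ i i′))
            ≡⟨ Sums.big-× (λ (j′ , i , i′) → F (yhole-gate j′ i i′)) ⟩
          ∑ (λ j′ → ∑ (λ ((i , i′) : Pigeon × Pigeon) → F (yhole-gate j′ i i′)))
            ≡⟨ Sums.big-cong (λ j′ → Sums.big-if (does (j Fin.≟ j′)) (λ (i , i′) → input-value ρ (hole-label j′ i i′))) ⟩
          ∑ (λ j′ → if does (j Fin.≟ j′) then pair-sum j′ else 0ℚ)
            ≡⟨ Sums.big-δ Fin._≟_ j pair-sum ⟩
          pair-sum j
            ≡⟨ Sums.big-× (λ (i , i′) → input-value ρ (hole-label j i i′)) ⟩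
          ∑ (λ i → ∑ (λ i′ → input-value ρ (hole-label j i i′))) ∎

      R-children : ∑ (summands R-gate) ≡ R-value
      R-children = begin
        ∑ F                                 ≡⟨ Sums.big-inj₁ F (λ _ → refl) ⟩
        ∑ (F ∘ inj₁)                        ≡⟨ Sums.big-inj₂ (F ∘ inj₁) (λ _ → refl) ⟩
        ∑ (F ∘ inj₁ ∘ inj₂)                 ≡⟨ Sums.big-inj₂ (F ∘ inj₁ ∘ inj₂) (λ _ → refl) ⟩
        ∑ (F ∘ inj₁ ∘ inj₂ ∘ inj₂)          ≡⟨ Sums.big-inj₂ (F ∘ inj₁ ∘ inj₂ ∘ inj₂) (λ _ → refl) ⟩
        ∑ (F ∘ inj₁ ∘ inj₂ ∘ inj₂ ∘ inj₂)   ≡⟨ Sums.big-inj₁ (F ∘ inj₁ ∘ inj₂ ∘ inj₂ ∘ inj₂) (λ _ → refl) ⟩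
        R-value                             ∎
        where
        F = summands R-gate

      T-children : ∀ j S → ∏ (factors (T-gate j S)) ≡ T-value j S
      T-children j S = begin
        ∏ F                          ≡⟨ Products.big-⊎ F ⟩
        ∏ (F ∘ inj₁) * ∏ (F ∘ inj₂)  ≡⟨ cong₂ _*_ inputs upper ⟩
        T-value j S                  ∎
        where
        F = factors (T-gate j S)

        inputs : ∏ (F ∘ inj₁) ≡ weight n (ℕ.suc ∣ S ∣) * absent S j
        inputs = begin
          ∏ (F ∘ inj₁)                                ≡⟨ Products.big-inj₂ (F ∘ inj₁) (λ _ → refl) ⟩
          ∏ (F ∘ inj₁ ∘ inj₂)                         ≡⟨ Products.big-inj₂ (F ∘ inj₁ ∘ inj₂) (λ _ → refl) ⟩
          ∏ (F ∘ inj₁ ∘ inj₂ ∘ inj₂)                  ≡⟨ Products.big-inj₂ (F ∘ inj₁ ∘ inj₂ ∘ inj₂) (λ _ → refl) ⟩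
          ∏ (F ∘ inj₁ ∘ inj₂ ∘ inj₂ ∘ inj₂)           ≡⟨ Products.big-inj₂ (F ∘ inj₁ ∘ inj₂ ∘ inj₂ ∘ inj₂) (λ _ → refl) ⟩
          ∏ (F ∘ inj₁ ∘ inj₂ ∘ inj₂ ∘ inj₂ ∘ inj₂)    ≡⟨ Products.big-⊎ (F ∘ inj₁ ∘ inj₂ ∘ inj₂ ∘ inj₂ ∘ inj₂) ⟩
          ∏ (λ S′ → F (weight-gate S′)) * ∏ (F ∘ inj₁ ∘ inj₂ ∘ inj₂ ∘ inj₂ ∘ inj₂ ∘ inj₂)
            ≡⟨ cong₂ _*_ (Products.big-δ _≟ˢ_ S (λ S′ → weight n (ℕ.suc ∣ S′ ∣)))
                         (trans (Products.big-inj₂ (F ∘ inj₁ ∘ inj₂ ∘ inj₂ ∘ inj₂ ∘ inj₂ ∘ inj₂) (λ _ → refl))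
                                (Products.big-⊤ (λ _ → F zero-gate))) ⟩
          weight n (ℕ.suc ∣ S ∣) * absent S j ∎

        upper : ∏ (F ∘ inj₂) ≡ monomial h-value S * B-value j
        upper = begin
          ∏ (F ∘ inj₂)                           ≡⟨ Products.big-inj₁ (F ∘ inj₂) (λ _ → refl) ⟩
          ∏ (F ∘ inj₂ ∘ inj₁)                    ≡⟨ Products.big-⊎ (F ∘ inj₂ ∘ inj₁) ⟩
          monomial h-value S * ∏ (F ∘ inj₂ ∘ inj₁ ∘ inj₂)
            ≡⟨ cong (monomial h-value S *_) (trans (Products.big-inj₁ (F ∘ inj₂ ∘ inj₁ ∘ inj₂) (λ _ → refl))
                                                   (Products.big-δ Fin._≟_ j B-value)) ⟩
          monomial h-value S * B-value j ∎

      U-children : ∀ S → ∏ (factors (U-gate S)) ≡ U-value S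
      U-children S = begin
        ∏ F                          ≡⟨ Products.big-⊎ F ⟩
        ∏ (F ∘ inj₁) * ∏ (F ∘ inj₂)  ≡⟨ cong₂ _*_ inputs upper ⟩
        U-value S                    ∎
        where
        F = factors (U-gate S)

        inputs : ∏ (F ∘ inj₁) ≡ - weight n ∣ S ∣
        inputs = begin
          ∏ (F ∘ inj₁)                                ≡⟨ Products.big-inj₂ (F ∘ inj₁) (λ _ → refl) ⟩
          ∏ (F ∘ inj₁ ∘ inj₂)                         ≡⟨ Products.big-inj₂ (F ∘ inj₁ ∘ inj₂) (λ _ → refl) ⟩
          ∏ (F ∘ inj₁ ∘ inj₂ ∘ inj₂)                  ≡⟨ Products.big-inj₂ (F ∘ inj₁ ∘ inj₂ ∘ inj₂) (λ _ → refl) ⟩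
          ∏ (F ∘ inj₁ ∘ inj₂ ∘ inj₂ ∘ inj₂)           ≡⟨ Products.big-inj₂ (F ∘ inj₁ ∘ inj₂ ∘ inj₂ ∘ inj₂) (λ _ → refl) ⟩
          ∏ (F ∘ inj₁ ∘ inj₂ ∘ inj₂ ∘ inj₂ ∘ inj₂)    ≡⟨ Products.big-inj₂ (F ∘ inj₁ ∘ inj₂ ∘ inj₂ ∘ inj₂ ∘ inj₂) (λ _ → refl) ⟩
          ∏ (F ∘ inj₁ ∘ inj₂ ∘ inj₂ ∘ inj₂ ∘ inj₂ ∘ inj₂) ≡⟨ Products.big-inj₁ (F ∘ inj₁ ∘ inj₂ ∘ inj₂ ∘ inj₂ ∘ inj₂ ∘ inj₂) (λ _ → refl) ⟩
          ∏ (λ S′ → F (neg-weight-gate S′))           ≡⟨ Products.big-δ _≟ˢ_ S (λ S′ → - weight n ∣ S′ ∣) ⟩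
          - weight n ∣ S ∣                            ∎

        upper : ∏ (F ∘ inj₂) ≡ monomial h-value S * R-value
        upper = begin
          ∏ (F ∘ inj₂)                           ≡⟨ Products.big-inj₁ (F ∘ inj₂) (λ _ → refl) ⟩
          ∏ (F ∘ inj₂ ∘ inj₁)                    ≡⟨ Products.big-⊎ (F ∘ inj₂ ∘ inj₁) ⟩
          monomial h-value S * ∏ (F ∘ inj₂ ∘ inj₁ ∘ inj₂)
            ≡⟨ cong (monomial h-value S *_) (trans (Products.big-inj₂ (F ∘ inj₂ ∘ inj₁ ∘ inj₂) (λ _ → refl))
                                                   (Products.big-⊤ (λ _ → R-value))) ⟩
          monomial h-value S * R-value ∎

      output-children : ∑ (summands out-gate) ≡ output-value
      output-children = begin
        ∑ F                          ≡⟨ Sums.big-inj₂ F (λ _ → refl) ⟩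
        ∑ (F ∘ inj₂)                 ≡⟨ Sums.big-inj₂ (F ∘ inj₂) (λ _ → refl) ⟩
        ∑ (F ∘ inj₂ ∘ inj₂)          ≡⟨ Sums.big-inj₁ (F ∘ inj₂ ∘ inj₂) (λ _ → refl) ⟩
        ∑ (F ∘ inj₂ ∘ inj₂ ∘ inj₁)   ≡⟨ Sums.big-⊎ (F ∘ inj₂ ∘ inj₂ ∘ inj₁) ⟩
        ∑ (λ ((j , S) : Hole × Subset n) → T-value j S) + ∑ U-value
                                     ≡⟨ cong (_+ ∑ U-value) (Sums.big-× (λ (j , S) → T-value j S)) ⟩
        output-value                 ∎
        where
        F = summands out-gate

      value-fixed : ∀ a → value a ≡ FiniteCircuit.gate-step php-finite-circuit ρ value a
      value-fixed (inj₁ c)     = sym (FiniteCircuit.gate-step-input php-finite-circuit ρ value (inj₁ c) (input-gate-is-input c))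
      value-fixed (h-gate j)   = sym (h-children j)
      value-fixed (B-gate j)   = sym (B-children j)
      value-fixed R-gate       = sym R-children
      value-fixed (T-gate j S) = sym (T-children j S)
      value-fixed (U-gate S)   = sym (U-children S)
      value-fixed out-gate     = sym output-children

      output-value-certificate : output-value ≡ ∑ (λ j → B-value j * D (weight n) h-value j) - R-value * Ψ (weight n) h-value
      output-value-certificate = begin
        ∑ (λ j → ∑ (T-value j)) + ∑ U-value
          ≡⟨ cong₂ _+_ (Sums.big-cong T-sum) U-sum ⟩
        ∑ (λ j → B-value j * D (weight n) h-value j) + - R-value * Ψ (weight n) h-value
          ≡⟨ cong (∑ (λ j → B-value j * D (weight n) h-value j) +_) (ℚ.neg-distribˡ-* R-value (Ψ (weight n) h-value)) ⟨
        ∑ (λ j → B-value j * D (weight n) h-value j) - R-value * Ψ (weight n) h-value ∎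
        where
        T-sum : ∀ j → ∑ (T-value j) ≡ B-value j * D (weight n) h-value j
        T-sum j = trans (Sums.big-cong (λ S → regroup (weight n (ℕ.suc ∣ S ∣)) (absent S j) (monomial h-value S) (B-value j)))
                        (∑-*ˡ (B-value j) (λ S → weight n (ℕ.suc ∣ S ∣) * (absent S j * monomial h-value S)))
          where
          regroup : ∀ w a m b → w * a * (m * b) ≡ b * (w * (a * m))
          regroup = solve-∀ ℚ-ring
        U-sum : ∑ U-value ≡ - R-value * Ψ (weight n) h-value
        U-sum = trans (Sums.big-cong (λ S → regroup (weight n ∣ S ∣) (monomial h-value S) R-value))
                      (∑-*ˡ (- R-value) (λ S → weight n ∣ S ∣ * monomial h-value S))
          where
          regroup : ∀ w m r → - w * (m * r) ≡ - r * (w * m)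
          regroup = solve-∀ ℚ-ring

    eval-php-circuit : ⦃ _ : ℕ.NonZero n ⦄ (ρ : Var n → ℚ) → let open Values ρ in
      eval php-circuit ρ ≡ ∑ (λ j → B-value j * D (weight n) h-value j) - R-value * Ψ (weight n) h-value
    eval-php-circuit ρ = trans (FiniteCircuit.eval-circuit php-finite-circuit ρ value value-fixed) output-value-certificate
      where open Values ρ

    holes : (XVar n → ℚ) → Hole → ℚ
    holes x j = ∑ (λ i → x (i , j))

    ordered-pair : (YVar n → ℚ) → Hole → Pigeon → Pigeon → ℚ
    ordered-pair f j i i′ with <-cmp i i′
    ... | tri< i<i′ _ _ = f (hole j i i′ i<i′)
    ... | _             = 0ℚ

    ordered-pair-< : ∀ f j {i i′} (i<i′ : i Fin.< i′) → ordered-pair f j i i′ ≡ f (hole j i i′ i<i′)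
    ordered-pair-< f j {i} {i′} i<i′ with <-cmp i i′
    ... | tri< i<i′₁ _ _ = cong (λ p → f (hole j i i′ p)) (<-irrelevant i<i′₁ i<i′)
    ... | tri≈ i≮i′ _ _  = ⊥-elim (i≮i′ i<i′)
    ... | tri> i≮i′ _ _  = ⊥-elim (i≮i′ i<i′)

    ordered-pair-≮ : ∀ f j {i i′} → ¬ i Fin.< i′ → ordered-pair f j i i′ ≡ 0ℚ
    ordered-pair-≮ f j {i} {i′} i≮i′ with <-cmp i i′
    ... | tri< i<i′ _ _ = ⊥-elim (i≮i′ i<i′)
    ... | tri≈ _ _ _    = refl
    ... | tri> _ _ _    = refl

    hole-label-value : ∀ x y j i i′ → input-value (assign x y) (hole-label j i i′) ≡ ordered-pair y j i i′ + ordered-pair y j i′ i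
    hole-label-value x y j i i′ with <-cmp i i′
    ... | tri< _ _ i′≮i    = sym (trans (cong (y (hole j i i′ _) +_) (ordered-pair-≮ y j i′≮i)) (ℚ.+-identityʳ _))
    ... | tri≈ _ _ i′≮i    = sym (trans (cong (0ℚ +_) (ordered-pair-≮ y j i′≮i)) (ℚ.+-identityʳ 0ℚ))
    ... | tri> _ _ i′<i    = sym (trans (cong (0ℚ +_) (ordered-pair-< y j i′<i)) (ℚ.+-identityˡ _))

    -- allY filters the hole axioms with a helper bound in a where-clause of Defs, which cannot be named here;
    -- the blocks below name it by unification, one index at a time (pair-blocks is stated over tabulate suc
    -- because at index zero the filter already computes).
    private
      bool-axioms row-axioms : List (YVar n)
      bool-axioms = concatMap (λ i → List.map (bool i) (allFin n)) (allFin (ℕ.suc n))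
      row-axioms  = List.map row (allFin (ℕ.suc n))

      hole-blocks : Σ[ W ∈ (Hole → List (YVar n)) ] allY n ≡ bool-axioms ++ row-axioms ++ concatMap W (allFin n)
      hole-blocks = _ , refl

      pigeon-blocks : Σ[ V ∈ (Hole → Pigeon → List (YVar n)) ] ∀ j → proj₁ hole-blocks j ≡ concatMap (V j) (allFin (ℕ.suc n))
      pigeon-blocks = _ , λ j → refl

      pair-blocks : Σ[ U ∈ (Hole → Pigeon → Pigeon → List (YVar n)) ]
        ∀ j i → proj₁ pigeon-blocks j i ≡ concat (List.map (U j i) (tabulate suc))
      pair-blocks = _ , λ j i → refl

      pigeon-block-pairs : ∀ j i → proj₁ pigeon-blocks j i ≡ concatMap (proj₁ pair-blocks j i) (allFin (ℕ.suc n))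
      pigeon-block-pairs j i = refl

    listSum-pair-blocks : ∀ f j i i′ → listSum f (proj₁ pair-blocks j i i′) ≡ ordered-pair f j i i′
    listSum-pair-blocks f j i i′ with i <? i′
    ... | yes i<i′ = trans (ℚ.+-identityʳ _) (sym (ordered-pair-< f j i<i′))
    ... | no  i≮i′ = sym (ordered-pair-≮ f j i≮i′)

    sumY-split : ∀ f → sumY f
               ≡ ∑ (λ i → ∑ (λ j → f (bool i j))) + (∑ (λ i → f (row i)) + ∑ (λ j → ∑ (λ i → ∑ (λ i′ → ordered-pair f j i i′))))
    sumY-split f = trans (cong (listSum f) (proj₂ hole-blocks)) (trans (listSum-++ f bool-axioms _)
      (cong₂ _+_ bools (trans (listSum-++ f row-axioms _) (cong₂ _+_ rows pairs))))
      where
      bools : listSum f bool-axioms ≡ ∑ (λ i → ∑ (λ j → f (bool i j)))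
      bools = trans (listSum-concatMap-allFin f (λ i → List.map (bool i) (allFin n)))
        (Sums.big-cong (λ i → trans (listSum-map f (bool i) (allFin n)) (listSum-allFin n (f ∘ bool i))))

      rows : listSum f row-axioms ≡ ∑ (λ i → f (row i))
      rows = trans (listSum-map f row (allFin (ℕ.suc n))) (listSum-allFin (ℕ.suc n) (f ∘ row))

      pairs : listSum f (concatMap (proj₁ hole-blocks) (allFin n)) ≡ ∑ (λ j → ∑ (λ i → ∑ (λ i′ → ordered-pair f j i i′)))
      pairs = trans (listSum-concatMap-allFin f (proj₁ hole-blocks)) (Sums.big-cong (λ j →
              trans (cong (listSum f) (proj₂ pigeon-blocks j)) (trans (listSum-concatMap-allFin f (proj₁ pigeon-blocks j)) (Sums.big-cong (λ i →
              trans (cong (listSum f) (pigeon-block-pairs j i)) (trans (listSum-concatMap-allFin f (proj₁ pair-blocks j i))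
                    (Sums.big-cong (listSum-pair-blocks f j i))))))))

    coefficient : YVar n → (XVar n → ℚ) → ℚ
    coefficient (bool i j)      x = D (weight n) (holes x) j
    coefficient (row i)         x = - Ψ (weight n) (holes x)
    coefficient (hole j i i′ _) x = D (weight n) (holes x) j + D (weight n) (holes x) j

    ordered-pair-coefficient : ∀ x y j i i′ →
      ordered-pair (λ k → y k * coefficient k x) j i i′ ≡ ordered-pair y j i i′ * (D (weight n) (holes x) j + D (weight n) (holes x) j)
    ordered-pair-coefficient x y j i i′ with <-cmp i i′
    ... | tri< _ _ _ = refl
    ... | tri≈ _ _ _ = sym (ℚ.*-zeroˡ (D (weight n) (holes x) j + D (weight n) (holes x) j))
    ... | tri> _ _ _ = sym (ℚ.*-zeroˡ (D (weight n) (holes x) j + D (weight n) (holes x) j))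

    hole-sum : ∀ x y j → ∑ (λ i → ∑ (λ i′ → input-value (assign x y) (hole-label j i i′)))
                       ≡ ∑ (λ i → ∑ (λ i′ → ordered-pair y j i i′)) + ∑ (λ i → ∑ (λ i′ → ordered-pair y j i i′))
    hole-sum x y j = begin
      ∑ (λ i → ∑ (λ i′ → input-value (assign x y) (hole-label j i i′)))
        ≡⟨ Sums.big-cong (λ i → trans (Sums.big-cong (hole-label-value x y j i)) (∑-+ (ordered-pair y j i) (λ i′ → ordered-pair y j i′ i))) ⟩
      ∑ (λ i → ∑ (λ i′ → ordered-pair y j i i′) + ∑ (λ i′ → ordered-pair y j i′ i))
        ≡⟨ ∑-+ (λ i → ∑ (λ i′ → ordered-pair y j i i′)) (λ i → ∑ (λ i′ → ordered-pair y j i′ i)) ⟩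
      ∑ (λ i → ∑ (λ i′ → ordered-pair y j i i′)) + ∑ (λ i → ∑ (λ i′ → ordered-pair y j i′ i))
        ≡⟨ cong (∑ (λ i → ∑ (λ i′ → ordered-pair y j i i′)) +_) (∑-comm (λ i i′ → ordered-pair y j i′ i)) ⟩
      ∑ (λ i → ∑ (λ i′ → ordered-pair y j i i′)) + ∑ (λ i → ∑ (λ i′ → ordered-pair y j i i′)) ∎

    php-circuit-linear : ⦃ _ : ℕ.NonZero n ⦄ → ∀ x y → eval php-circuit (assign x y) ≡ sumY (λ k → y k * coefficient k x)
    php-circuit-linear x y = begin
      eval php-circuit (assign x y)
        ≡⟨ eval-php-circuit (assign x y) ⟩
      ∑ (λ j → (Yb j + H j) * D′ j) - R * Ψ′
        ≡⟨ cong (λ t → t - R * Ψ′) (Sums.big-cong (λ j → cong (λ h → (Yb j + h) * D′ j) (hole-sum x y j))) ⟩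
      ∑ (λ j → (Yb j + (P j + P j)) * D′ j) - R * Ψ′
        ≡⟨ cong (λ t → t - R * Ψ′) (trans (Sums.big-cong (λ j → distribute (Yb j) (P j) (D′ j)))
                                          (∑-+ (λ j → Yb j * D′ j) (λ j → P j * (D′ j + D′ j)))) ⟩
      (∑ (λ j → Yb j * D′ j) + ∑ (λ j → P j * (D′ j + D′ j))) - R * Ψ′
        ≡⟨ regroup (∑ (λ j → Yb j * D′ j)) (∑ (λ j → P j * (D′ j + D′ j))) R Ψ′ ⟩
      ∑ (λ j → Yb j * D′ j) + (R * - Ψ′ + ∑ (λ j → P j * (D′ j + D′ j)))
        ≡⟨ cong₂ (λ a b → a + b) bools (cong₂ _+_ rows pairs) ⟩
      ∑ (λ i → ∑ (λ j → y (bool i j) * D′ j)) + (∑ (λ i → y (row i) * - Ψ′)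
        + ∑ (λ j → ∑ (λ i → ∑ (λ i′ → ordered-pair (λ k → y k * coefficient k x) j i i′))))
        ≡⟨ sumY-split (λ k → y k * coefficient k x) ⟨
      sumY (λ k → y k * coefficient k x) ∎
      where
      open Values (assign x y) using () renaming (R-value to R)
      D′ : Hole → ℚ
      D′ = D (weight n) (holes x)
      Ψ′ = Ψ (weight n) (holes x)
      Yb H P : Hole → ℚ
      Yb j = ∑ (λ i → y (bool i j))
      H j = ∑ (λ i → ∑ (λ i′ → input-value (assign x y) (hole-label j i i′)))
      P j = ∑ (λ i → ∑ (λ i′ → ordered-pair y j i i′))

      distribute : ∀ b p d → (b + (p + p)) * d ≡ b * d + p * (d + d)
      distribute = solve-∀ ℚ-ring
      regroup : ∀ a b r p → (a + b) - r * p ≡ a + (r * - p + b)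
      regroup = solve-∀ ℚ-ring

      bools : ∑ (λ j → Yb j * D′ j) ≡ ∑ (λ i → ∑ (λ j → y (bool i j) * D′ j))
      bools = trans (Sums.big-cong (λ j → sym (∑-*ʳ (D′ j) (λ i → y (bool i j))))) (∑-comm (λ j i → y (bool i j) * D′ j))
      rows : R * - Ψ′ ≡ ∑ (λ i → y (row i) * - Ψ′)
      rows = sym (∑-*ʳ (- Ψ′) (λ i → y (row i)))
      pairs : ∑ (λ j → P j * (D′ j + D′ j)) ≡ ∑ (λ j → ∑ (λ i → ∑ (λ i′ → ordered-pair (λ k → y k * coefficient k x) j i i′)))
      pairs = Sums.big-cong (λ j → trans (sym (∑-*ʳ (D′ j + D′ j) (λ i → ∑ (ordered-pair y j i)))) (Sums.big-cong (λ i →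
                trans (sym (∑-*ʳ (D′ j + D′ j) (ordered-pair y j i))) (Sums.big-cong (λ i′ → sym (ordered-pair-coefficient x y j i i′))))))

    php-assignment : (XVar n → ℚ) → Var n → ℚ
    php-assignment x = assign x (λ k → php k x)

    hole-label-php : ∀ x j i i′ → input-value (php-assignment x) (hole-label j i i′)
                   ≡ x (i , j) * x (i′ , j) - (if does (i Fin.≟ i′) then x (i , j) * x (i′ , j) else 0ℚ)
    hole-label-php x j i i′ with <-cmp i i′
    ... | tri< _ i≢i′ _ rewrite dec-false (i Fin.≟ i′) i≢i′ = sym (ℚ.+-identityʳ _)
    ... | tri≈ _ i≡i′ _ rewrite dec-true (i Fin.≟ i′) i≡i′  = sym (ℚ.+-inverseʳ (x (i , j) * x (i′ , j)))
    ... | tri> _ i≢i′ _ rewrite dec-false (i Fin.≟ i′) i≢i′ = trans (ℚ.*-comm (x (i′ , j)) (x (i , j))) (sym (ℚ.+-identityʳ _))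

    B-value-php : ⦃ _ : ℕ.NonZero n ⦄ → ∀ x j → Values.B-value (php-assignment x) j ≡ holes x j * holes x j - holes x j
    B-value-php x j = begin
      ∑ (λ i → a i * a i - a i) + ∑ (λ i → ∑ (λ i′ → input-value (php-assignment x) (hole-label j i i′)))
        ≡⟨ cong₂ _+_ (∑-- (λ i → a i * a i) a) (Sums.big-cong (λ i → trans (Sums.big-cong (hole-label-php x j i)) (row-sum i))) ⟩
      (∑ (λ i → a i * a i) - h) + ∑ (λ i → a i * h - a i * a i)
        ≡⟨ cong ((∑ (λ i → a i * a i) - h) +_) (trans (∑-- (λ i → a i * h) (λ i → a i * a i)) (cong (_- ∑ (λ i → a i * a i)) (∑-*ʳ h a))) ⟩
      (∑ (λ i → a i * a i) - h) + (h * h - ∑ (λ i → a i * a i))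
        ≡⟨ cancel (∑ (λ i → a i * a i)) h ⟩
      h * h - h ∎
      where
      a : Pigeon → ℚ
      a i = x (i , j)
      h = holes x j

      row-sum : ∀ i → ∑ (λ i′ → a i * a i′ - (if does (i Fin.≟ i′) then a i * a i′ else 0ℚ)) ≡ a i * h - a i * a i
      row-sum i = trans (∑-- (λ i′ → a i * a i′) (λ i′ → if does (i Fin.≟ i′) then a i * a i′ else 0ℚ))
                        (cong₂ _-_ (∑-*ˡ (a i) a) (Sums.big-δ Fin._≟_ i (λ i′ → a i * a i′)))

      cancel : ∀ s h → (s - h) + (h * h - s) ≡ h * h - h
      cancel = solve-∀ ℚ-ring

    R-value-php : ⦃ _ : ℕ.NonZero n ⦄ → ∀ x → Values.R-value (php-assignment x) ≡ ∑ (holes x) - fromℕ (ℕ.suc n)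
    R-value-php x = begin
      ∑ (λ i → listSum (λ j → x (i , j)) (allFin n) - 1ℚ)
        ≡⟨ Sums.big-cong (λ i → cong (_- 1ℚ) (listSum-allFin n (λ j → x (i , j)))) ⟩
      ∑ (λ i → ∑ (λ j → x (i , j)) - 1ℚ)
        ≡⟨ ∑-- (λ i → ∑ (λ j → x (i , j))) (λ _ → 1ℚ) ⟩
      ∑ (λ i → ∑ (λ j → x (i , j))) - ∑ (λ (_ : Pigeon) → 1ℚ)
        ≡⟨ cong₂ _-_ (∑-comm (λ i j → x (i , j))) (sum-replicate (ℕ.suc n) {1ℚ}) ⟩
      ∑ (holes x) - fromℕ (ℕ.suc n) ∎

    php-circuit-refutes : ⦃ _ : ℕ.NonZero n ⦄ → ∀ x → eval php-circuit (php-assignment x) ≡ 1ℚ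
    php-circuit-refutes x = begin
      eval php-circuit (php-assignment x)
        ≡⟨ eval-php-circuit (php-assignment x) ⟩
      ∑ (λ j → B-value j * D (weight n) (holes x) j) - R-value * Ψ (weight n) (holes x)
        ≡⟨ cong₂ (λ b r → b - r * Ψ (weight n) (holes x))
                 (Sums.big-cong (λ j → cong (_* D (weight n) (holes x) j) (B-value-php x j))) (R-value-php x) ⟩
      ∑ (λ j → (holes x j * holes x j - holes x j) * D (weight n) (holes x) j) - (∑ (holes x) - fromℕ (ℕ.suc n)) * Ψ (weight n) (holes x)
        ≡⟨ certificate-identity (holes x) ⟩
      1ℚ ∎
      where
      open Values (php-assignment x)

    private
      length-pair-blocks : ∀ j i i′ → List.length (proj₁ pair-blocks j i i′) ℕ.≤ 1
      length-pair-blocks j i i′ with i <? i′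
      ... | yes _ = ℕ.≤-refl
      ... | no  _ = ℕ.z≤n

    variable-count : List.length (allX n) ℕ.+ List.length (allY n)
                   ℕ.≤ ℕ.suc n ℕ.* n ℕ.+ (ℕ.suc n ℕ.* n ℕ.+ (ℕ.suc n ℕ.+ n ℕ.* (ℕ.suc n ℕ.* (ℕ.suc n ℕ.* 1))))
    variable-count = ℕ.+-mono-≤ xs (ℕ.≤-trans (ℕ.≤-reflexive (cong List.length (proj₂ hole-blocks)))
      (ℕ.≤-trans (ℕ.≤-reflexive (ListP.length-++ bool-axioms)) (ℕ.+-mono-≤ bools
      (ℕ.≤-trans (ℕ.≤-reflexive (ListP.length-++ row-axioms)) (ℕ.+-mono-≤ rows pairs)))))
      where
      xs : List.length (allX n) ℕ.≤ ℕ.suc n ℕ.* n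
      xs = length-concatMap-allFin (λ i → List.map (λ j → (i , j)) (allFin n)) (λ i → ℕ.≤-reflexive (length-map-allFin _))
      bools : List.length bool-axioms ℕ.≤ ℕ.suc n ℕ.* n
      bools = length-concatMap-allFin (λ i → List.map (bool i) (allFin n)) (λ i → ℕ.≤-reflexive (length-map-allFin (bool i)))
      rows : List.length row-axioms ℕ.≤ ℕ.suc n
      rows = ℕ.≤-reflexive (length-map-allFin row)
      pairs : List.length (concatMap (proj₁ hole-blocks) (allFin n)) ℕ.≤ n ℕ.* (ℕ.suc n ℕ.* (ℕ.suc n ℕ.* 1))
      pairs = length-concatMap-allFin (proj₁ hole-blocks) (λ j →
                subst (ℕ._≤ _) (cong List.length (sym (proj₂ pigeon-blocks j))) (length-concatMap-allFin (proj₁ pigeon-blocks j) (λ i →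
                subst (ℕ._≤ _) (cong List.length (sym (pigeon-block-pairs j i)))
                  (length-concatMap-allFin (proj₁ pair-blocks j i) (length-pair-blocks j i)))))

    gate-count : cardinality Gate ≡ gate-polynomial n (2 ^ n)
    gate-count = trans (expand n (cardinality (Subset n))) (cong (gate-polynomial n) (cardinality-Subset n))
      where
      expand : ∀ n s → ℕ.suc n ℕ.* n ℕ.+ (ℕ.suc n ℕ.* n ℕ.+ (n ℕ.* (ℕ.suc n ℕ.* ℕ.suc n) ℕ.+ (ℕ.suc n ℕ.+ (s ℕ.+ (s ℕ.+ 1)))))
                     ℕ.+ ((n ℕ.+ (n ℕ.+ 1)) ℕ.+ ((n ℕ.* s ℕ.+ s) ℕ.+ 1))
                     ≡ n ℕ.* (n ℕ.* n) ℕ.+ 4 ℕ.* (n ℕ.* n) ℕ.+ 6 ℕ.* n ℕ.+ 4 ℕ.+ 3 ℕ.* s ℕ.+ n ℕ.* s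
      expand = ℕ-solve-∀

    variables≤gates : List.length (allX n) ℕ.+ List.length (allY n) ℕ.≤ cardinality Gate
    variables≤gates = ℕ.≤-trans variable-count (ℕ.≤-trans (ℕ.m≤m+n V (s ℕ.+ (s ℕ.+ 1)))
      (ℕ.≤-trans (ℕ.≤-reflexive (regroup n s)) (ℕ.m≤m+n (cardinality InputGate) (cardinality (SumGate ⊎ ProductGate ⊎ ⊤)))))
      where
      s = cardinality (Subset n)
      V = ℕ.suc n ℕ.* n ℕ.+ (ℕ.suc n ℕ.* n ℕ.+ (ℕ.suc n ℕ.+ n ℕ.* (ℕ.suc n ℕ.* (ℕ.suc n ℕ.* 1))))
      regroup : ∀ n s → ℕ.suc n ℕ.* n ℕ.+ (ℕ.suc n ℕ.* n ℕ.+ (ℕ.suc n ℕ.+ n ℕ.* (ℕ.suc n ℕ.* (ℕ.suc n ℕ.* 1))))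
                          ℕ.+ (s ℕ.+ (s ℕ.+ 1))
                      ≡ ℕ.suc n ℕ.* n ℕ.+ (ℕ.suc n ℕ.* n ℕ.+ (n ℕ.* (ℕ.suc n ℕ.* ℕ.suc n) ℕ.+ (ℕ.suc n ℕ.+ (s ℕ.+ (s ℕ.+ 1)))))
      regroup = ℕ-solve-∀

    php-circuit-size : ⦃ _ : ℕ.NonZero n ⦄ → size php-circuit ℕ.≤ 19 ℕ.* 3 ^ n ℕ.* n
    php-circuit-size = ℕ.⊔-lub gates-bound (ℕ.≤-trans variables≤gates gates-bound)
      where
      gates-bound : cardinality Gate ℕ.≤ 19 ℕ.* 3 ^ n ℕ.* n
      gates-bound = subst (ℕ._≤ 19 ℕ.* 3 ^ n ℕ.* n) (sym gate-count)
        (gate-polynomial-bound n (2 ^ n) (ℕ.>-nonZero⁻¹ n) (ℕ.^-monoˡ-≤ n (ℕ.n≤1+n 2)))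

    php-circuit-vanishes : ⦃ _ : ℕ.NonZero n ⦄ → ∀ x → eval php-circuit (assign x (λ _ → 0ℚ)) ≡ 0ℚ
    php-circuit-vanishes x = trans (php-circuit-linear x (λ _ → 0ℚ)) (listSum-zero (allY n) (λ k → ℚ.*-zeroˡ (coefficient k x)))

open import Data.Nat using (_≤_; _*_)

theorem6p7 : ∃ λ (c : ℕ) → ∀ (n : ℕ) → 1 ≤ n →
    Σ[ C ∈ Circuit (Var n) ]
      (IsIPSRefutation C × YLinear C × Symmetric act C × size C ≤ c * 3 ^ n * n)
theorem6p7 = 19 , certificate
  where
  certificate : ∀ n → 1 ≤ n → Σ[ C ∈ Circuit (Var n) ] (IsIPSRefutation C × YLinear C × Symmetric act C × size C ≤ 19 * 3 ^ n * n)
  certificate n 1≤n =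
    php-circuit , (php-circuit-vanishes , php-circuit-refutes) , (coefficient , php-circuit-linear) , php-circuit-symmetric , php-circuit-size
    where
    open PHP-Certificate n
    instance
      n≢0 : ℕ.NonZero n
      n≢0 = ℕ.>-nonZero 1≤n
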